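{- Let $(G,\mathcal{P})$ be a single-flow directed multipartite graph with three layers, $|V_1(G)|=a$, $|V_2(G)|=b$, $|V_3(G)|=c$, and let $g=\gcd(b,c)$ and $l=\operatorname{lcm}(b,c)$. Then $\operatorname{Pic}(G)\cong\mathbb{Z}^c\times\operatorname{Jac}(G)$, where $\operatorname{Jac}(G)\cong 0$ if $b=1$; $\operatorname{Jac}(G)\cong\mathbb{Z}_g^{\,b-2}\times\mathbb{Z}_b^{\,a-b+1}\times\mathbb{Z}_l^{\,b-2}\times\mathbb{Z}_{bc}$ if $a\ge b-1$ and $b\ge2$; $\operatorname{Jac}(G)\cong\mathbb{Z}_g^{\,a-1}\times\mathbb{Z}_c^{\,b-a-1}\times\mathbb{Z}_l^{\,a-1}\times\mathbb{Z}_{bc}$ if $a\le b-1$.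
   Context: A single-flow directed multipartite graph with $t$ layers is a directed graph $G$ with a partition $V(G)=V_1(G)\sqcup\dots\sqcup V_t(G)$ into nonempty parts such that the arrows of $G$ are exactly one one-directional arrow $u\to v$ for each $i\in\{1,\dots,t-1\}$, $u\in V_i(G)$, $v\in V_{i+1}(G)$. The Laplacian $L_G$ of a directed graph on $v_1,\dots,v_n$ is the $n\times n$ integer matrix with $(i,i)$ entry the number of outgoing arrows of $v_i$ and $(i,j)$ entry ($i\ne j$) minus the number of arrows from $v_i$ to $v_j$. $\operatorname{Pic}(G)=\mathbb{Z}^n/L_G^T\mathbb{Z}^n$, $\operatorname{Jac}(G)$ is its torsion subgroup, $\mathbb{Z}_m=\mathbb{Z}/m\mathbb{Z}$. -}

module Defs where

open import Level using (0ℓ)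
open import Data.Nat as ℕ using (ℕ; zero; suc)
open import Data.Nat.GCD using (gcd)
open import Data.Nat.LCM using (lcm)
open import Data.Integer as ℤ using (ℤ; +_; -_; _-_; -[1+_])
open import Data.Integer.Divisibility using (_∣_)
open import Data.Fin as Fin using (Fin)
open import Data.Vec using (allFin; count)
open import Data.Bool using (Bool; true; false; if_then_else_)
open import Data.Unit using (⊤; tt)
open import Data.Product using (Σ; ∃; _×_; _,_; proj₁)
open import Relation.Nullary.Decidable using (does)
open import Relation.Binary.PropositionalEquality using (_≡_; refl; sym; trans; cong; cong₂)
open import Data.Integer.Solver using (module +-*-Solver)
open +-*-Solver
open import Data.Integer.Properties using (pos-*)
open import Algebra.Bundles.Raw using (RawGroup)
open import Algebra.Morphism.Structures using (module GroupMorphisms)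

Σℤ : ∀ {n} → (Fin n → ℤ) → ℤ
Σℤ {zero}  f = + 0
Σℤ {suc n} f = f Fin.zero ℤ.+ Σℤ (λ i → f (Fin.suc i))

Σℕ : ∀ {n} → (Fin n → ℕ) → ℕ
Σℕ {zero}  f = 0
Σℕ {suc n} f = f Fin.zero ℕ.+ Σℕ (λ i → f (Fin.suc i))

-- Directed (multi)graphs on the vertex set Fin n:
-- arr u v = number of arrows u → v.

record DiGraph (n : ℕ) : Set where
  field
    arr : Fin n → Fin n → ℕ

outdeg : ∀ {n} → DiGraph n → Fin n → ℕ
outdeg G u = Σℕ (λ v → DiGraph.arr G u v)

Laplacian : ∀ {n} → DiGraph n → Fin n → Fin n → ℤ
Laplacian G i j =
  if does (i Fin.≟ j) then + outdeg G i else - (+ DiGraph.arr G i j)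

-- Single-flow directed multipartite graphs with t layers.
-- layer : Fin n → Fin t gives the partition V = V_1 ⊔ … ⊔ V_t
-- (layer index k : Fin t stands for V_{k+1}).

NextLayer : ∀ {t} → Fin t → Fin t → Bool
NextLayer {t} i j = does (suc (Fin.toℕ i) ℕ.≟ Fin.toℕ j)

layerSize : ∀ {n t} → (Fin n → Fin t) → Fin t → ℕ
layerSize {n} layer k = count (λ v → layer v Fin.≟ k) (allFin n)

IsSingleFlow : ∀ {n t} → DiGraph n → (Fin n → Fin t) → Set
IsSingleFlow {n} {t} G layer =
  (∀ k → 1 ℕ.≤ layerSize layer k) ×
  (∀ u v → DiGraph.arr G u v ≡ (if NextLayer (layer u) (layer v) then 1 else 0))

-- ℤ^n / L^T ℤ^n : u ≈ v iff u - v = L^T x for some x ∈ ℤ^n,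
-- where (L^T x)_j = Σ_i L_{ij} x_i.
PicRel : ∀ {n} → DiGraph n → (Fin n → ℤ) → (Fin n → ℤ) → Set
PicRel {n} G u v =
  ∃ λ (x : Fin n → ℤ) → ∀ j → u j - v j ≡ Σℤ (λ i → Laplacian G i j ℤ.* x i)

Pic : ∀ {n} → DiGraph n → RawGroup 0ℓ 0ℓ
Pic {n} G = record
  { Carrier = Fin n → ℤ
  ; _≈_     = PicRel G
  ; _∙_     = λ u v i → u i ℤ.+ v i
  ; ε       = λ _ → + 0
  ; _⁻¹     = λ u i → - u i
  }

scale : ∀ {n} → ℕ → (Fin n → ℤ) → (Fin n → ℤ)
scale k u i = + k ℤ.* u i

IsTorsion : ∀ {n} → DiGraph n → (Fin n → ℤ) → Set
IsTorsion G u = ∃ λ k → (1 ℕ.≤ k) × PicRel G (scale k u) (λ _ → + 0)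

Σℤ-lin : ∀ {n} (a x y : Fin n → ℤ) (p q : ℤ) →
         Σℤ (λ i → a i ℤ.* (p ℤ.* x i ℤ.+ q ℤ.* y i))
           ≡ p ℤ.* Σℤ (λ i → a i ℤ.* x i) ℤ.+ q ℤ.* Σℤ (λ i → a i ℤ.* y i)
Σℤ-lin {zero} a x y p q =
  solve 2 (λ p q → con (+ 0) := p :* con (+ 0) :+ q :* con (+ 0)) refl p q
Σℤ-lin {suc n} a x y p q
  rewrite Σℤ-lin (λ i → a (Fin.suc i)) (λ i → x (Fin.suc i)) (λ i → y (Fin.suc i)) p q =
  solve 7 (λ a0 x0 y0 p q s t →
    a0 :* (p :* x0 :+ q :* y0) :+ (p :* s :+ q :* t)
      := p :* (a0 :* x0 :+ s) :+ q :* (a0 :* y0 :+ t))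
    refl (a Fin.zero) (x Fin.zero) (y Fin.zero) p q
    (Σℤ (λ i → a (Fin.suc i) ℤ.* x (Fin.suc i)))
    (Σℤ (λ i → a (Fin.suc i) ℤ.* y (Fin.suc i)))

module _ {n} (G : DiGraph n) where
  private
    L = Laplacian G
    0v : Fin n → ℤ
    0v _ = + 0

  zero-torsion : PicRel G (scale 1 0v) 0v
  zero-torsion = 0v , λ j →
    trans (solve 0 (con (+ 1) :* con (+ 0) :- con (+ 0) := con (+ 0) :* con (+ 0) :+ con (+ 0) :* con (+ 0)) refl)
          (sym (Σℤ-lin (λ i → L i j) 0v 0v (+ 0) (+ 0)))

  torsion-neg : ∀ u k → PicRel G (scale k u) 0v →
                PicRel G (scale k (λ i → - u i)) 0v
  torsion-neg u k (x , px) = (λ i → -[1+ 0 ] ℤ.* x i ℤ.+ + 0 ℤ.* x i) , λ j →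
    trans (trans
      (solve 2 (λ k uj → k :* (:- uj) :- con (+ 0) := con -[1+ 0 ] :* (k :* uj :- con (+ 0))) refl (+ k) (u j))
      (trans (cong (-[1+ 0 ] ℤ.*_) (px j))
        (solve 1 (λ s → con -[1+ 0 ] :* s := con -[1+ 0 ] :* s :+ con (+ 0) :* s) refl
               (Σℤ (λ i → L i j ℤ.* x i)))))
      (sym (Σℤ-lin (λ i → L i j) x x -[1+ 0 ] (+ 0)))

  torsion-sum : ∀ u v k m → 1 ℕ.≤ k → 1 ℕ.≤ m →
                PicRel G (scale k u) 0v → PicRel G (scale m v) 0v →
                ∃ λ r → (1 ℕ.≤ r) × PicRel G (scale r (λ i → u i ℤ.+ v i)) 0v
  torsion-sum u v (suc k) (suc m) _ _ (x , px) (y , py) =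
    suc k ℕ.* suc m , ℕ.s≤s ℕ.z≤n ,
    ((λ i → + suc m ℤ.* x i ℤ.+ + suc k ℤ.* y i) , λ j →
      trans (trans
        (trans (cong (λ z → z ℤ.* (u j ℤ.+ v j) ℤ.- + 0) (sym (pos-* (suc k) (suc m))))
          (solve 4 (λ K M uj vj → K :* M :* (uj :+ vj) :- con (+ 0)
              := M :* (K :* uj :- con (+ 0)) :+ K :* (M :* vj :- con (+ 0)))
            refl (+ suc k) (+ suc m) (u j) (v j)))
        (cong₂ (λ s t → + suc m ℤ.* s ℤ.+ + suc k ℤ.* t) (px j) (py j)))
      (sym (Σℤ-lin (λ i → L i j) x y (+ suc m) (+ suc k))))

Jac : ∀ {n} → DiGraph n → RawGroup 0ℓ 0ℓ
Jac {n} G = record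
  { Carrier = Σ (Fin n → ℤ) (IsTorsion G)
  ; _≈_     = λ u v → PicRel G (proj₁ u) (proj₁ v)
  ; _∙_     = λ { (u , k , k≥1 , pu) (v , m , m≥1 , pv) →
                (λ i → u i ℤ.+ v i) , torsion-sum G u v k m k≥1 m≥1 pu pv }
  ; ε       = (λ _ → + 0) , 1 , ℕ.s≤s ℕ.z≤n , zero-torsion G
  ; _⁻¹     = λ { (u , k , k≥1 , pu) → (λ i → - u i) , k , k≥1 , torsion-neg G u k pu }
  }

ℤ-group : RawGroup 0ℓ 0ℓ
ℤ-group = record
  { Carrier = ℤ ; _≈_ = _≡_ ; _∙_ = ℤ._+_ ; ε = + 0 ; _⁻¹ = -_ }

ℤmod : ℕ → RawGroup 0ℓ 0ℓ
ℤmod m = record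
  { Carrier = ℤ ; _≈_ = λ x y → (+ m) ∣ (x - y) ; _∙_ = ℤ._+_ ; ε = + 0 ; _⁻¹ = -_ }

trivialGroup : RawGroup 0ℓ 0ℓ
trivialGroup = record
  { Carrier = ⊤ ; _≈_ = λ _ _ → ⊤ ; _∙_ = λ _ _ → tt ; ε = tt ; _⁻¹ = λ _ → tt }

infixr 6 _⊗_
_⊗_ : RawGroup 0ℓ 0ℓ → RawGroup 0ℓ 0ℓ → RawGroup 0ℓ 0ℓ
G ⊗ H = record
  { Carrier = G.Carrier × H.Carrier
  ; _≈_     = λ { (g , h) (g' , h') → (g G.≈ g') × (h H.≈ h') }
  ; _∙_     = λ { (g , h) (g' , h') → (g G.∙ g') , (h H.∙ h') }
  ; ε       = G.ε , H.ε
  ; _⁻¹     = λ { (g , h) → (g G.⁻¹) , (h H.⁻¹) }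
  }
  where
  module G = RawGroup G
  module H = RawGroup H

infixr 8 _^_
_^_ : RawGroup 0ℓ 0ℓ → ℕ → RawGroup 0ℓ 0ℓ
G ^ zero  = trivialGroup
G ^ suc k = G ⊗ (G ^ k)

infix 4 _≅_
_≅_ : RawGroup 0ℓ 0ℓ → RawGroup 0ℓ 0ℓ → Set
G ≅ H = ∃ λ (f : RawGroup.Carrier G → RawGroup.Carrier H) →
          GroupMorphisms.IsGroupIsomorphism G H f

module Submission where

-- Pic(G) = ℤⁿ / im Lᵀ, and for a single-flow graph with layers V₁, V₂, V₃ of sizes a, b, c the map Lᵀ is
-- explicit: (Lᵀ x)(p) = b x(p) on V₁, (Lᵀ x)(q) = c x(q) − S₁ x on V₂ and (Lᵀ x)(r) = −S₂ x on V₃, where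
-- Sᵢ sums over Vᵢ. Hence the c functionals S₁ + S₂ + c u(r₀) and u(rₖ) − u(r₀) (k ≥ 1) vanish on im Lᵀ
-- and give a free quotient ℤ^c. When b ≥ 2, the functionals u(pᵢ) (i ≥ 1), u(qⱼ) − u(q₁) (j ≥ 2) and
-- S₁ u + b u(q₁) are multiples of b, c and bc on im Lᵀ, so they give a map onto ℤ_b^(a−1) × ℤ_c^(b−2) × ℤ_bc.
-- Explicit representatives invert both maps, so Pic(G) ≅ ℤ^c × Jac(G) with Jac(G) that finite group
-- (trivial when b = 1). Finally ℤ_b × ℤ_c ≅ ℤ_gcd × ℤ_lcm pairs off min(a − 1, b − 2) copies.

module ThreeLayerPicard where

  open import Level using (0ℓ) renaming (suc to lsuc)
  open import Defs
  open import Data.Nat as ℕ using (ℕ; zero; suc; NonZero)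
  import Data.Nat.Properties as ℕ
  import Data.Nat.Divisibility as ℕ
  open import Data.Nat.GCD using (gcd; gcd[m,n]∣m; gcd[m,n]∣n; gcd[m,n]≢0; gcd-GCD; module Bézout)
  open import Data.Nat.LCM using (lcm; gcd*lcm)
  open import Data.Fin as Fin using (Fin; zero; suc; _≟_; toℕ)
  open import Data.Fin.Properties using (suc-injective)
  open import Data.Integer as ℤ using (ℤ; +_; -_; _-_; _+_; _*_)
  import Data.Integer.Properties as ℤ
  open import Data.Integer.Divisibility.Signed as ∣ using (_∣_; divides)
  open import Data.Integer.Tactic.RingSolver using (solve-∀)
  open import Data.Bool using (false; if_then_else_)
  open import Data.Empty using (⊥-elim)
  open import Data.Product using (∃₂; _×_; _,_; proj₁; proj₂)
  open import Data.Sum using (_⊎_; inj₁; inj₂; map₁; map₂)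
  open import Data.Unit using (⊤; tt)
  open import Data.Vec using (count; tabulate)
  open import Function using (id; _∘_)
  open import Algebra.Bundles.Raw using (RawGroup)
  open import Algebra.Definitions using (Congruent₁; Congruent₂)
  open import Algebra.Morphism.Structures using (module GroupMorphisms)
  import Algebra.Morphism.Construct.Composition as Composition
  import Algebra.Morphism.Construct.Identity as Identity
  open import Relation.Nullary using (yes; no; does)
  open import Relation.Nullary.Decidable using (dec-false)
  open import Relation.Binary.Structures using (IsEquivalence)
  open import Relation.Binary.Bundles using (Setoid)
  import Relation.Binary.Reasoning.Setoid
  open import Relation.Binary.PropositionalEquality as ≡
    using (_≡_; _≢_; refl; cong; cong₂; sym; trans; subst)

  -- Congruent raw groups and their isomorphisms

  -- The raw groups of Defs carry no laws; isomorphisms can only be composed and inverted once ≈ is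
  -- known to be an equivalence respected by the operations.
  record IsCongruent (G : RawGroup 0ℓ 0ℓ) : Set where
    open RawGroup G
    field
      isEquivalence : IsEquivalence _≈_
      ∙-cong        : Congruent₂ _≈_ _∙_
      ⁻¹-cong       : Congruent₁ _≈_ _⁻¹
    open IsEquivalence isEquivalence public

  record CongruentGroup : Set₁ where
    field
      rawGroup    : RawGroup 0ℓ 0ℓ
      isCongruent : IsCongruent rawGroup
    open RawGroup rawGroup public
    open IsCongruent isCongruent public

    setoid : Setoid 0ℓ 0ℓ
    setoid = record { isEquivalence = isEquivalence }

  ⌊_⌋ : CongruentGroup → RawGroup 0ℓ 0ℓ
  ⌊_⌋ = CongruentGroup.rawGroup

  infix 4 _≃_
  _≃_ : CongruentGroup → CongruentGroup → Set
  A ≃ B = ⌊ A ⌋ ≅ ⌊ B ⌋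

  trivialᶜ : CongruentGroup
  trivialᶜ = record
    { rawGroup    = trivialGroup
    ; isCongruent = record
      { isEquivalence = record { refl = tt ; sym = λ _ → tt ; trans = λ _ _ → tt }
      ; ∙-cong = λ _ _ → tt ; ⁻¹-cong = λ _ → tt } }

  ℤᶜ : CongruentGroup
  ℤᶜ = record
    { rawGroup    = ℤ-group
    ; isCongruent = record
      { isEquivalence = ≡.isEquivalence ; ∙-cong = ≡.cong₂ _ ; ⁻¹-cong = ≡.cong _ } }

  infixr 6 _⊗ᶜ_
  _⊗ᶜ_ : CongruentGroup → CongruentGroup → CongruentGroup
  A ⊗ᶜ B = record
    { rawGroup    = ⌊ A ⌋ ⊗ ⌊ B ⌋
    ; isCongruent = record
      { isEquivalence = record
        { refl  = A.refl , B.refl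
        ; sym   = λ (p , q) → A.sym p , B.sym q
        ; trans = λ (p , q) (p′ , q′) → A.trans p p′ , B.trans q q′ }
      ; ∙-cong  = λ (p , q) (p′ , q′) → A.∙-cong p p′ , B.∙-cong q q′
      ; ⁻¹-cong = λ (p , q) → A.⁻¹-cong p , B.⁻¹-cong q } }
    where
    module A = CongruentGroup A
    module B = CongruentGroup B

  infixr 8 _^ᶜ_
  _^ᶜ_ : CongruentGroup → ℕ → CongruentGroup
  A ^ᶜ k = record { rawGroup = ⌊ A ⌋ ^ k ; isCongruent = isCongruent k }
    where
    isCongruent : ∀ k → IsCongruent (⌊ A ⌋ ^ k)
    isCongruent zero    = CongruentGroup.isCongruent trivialᶜ
    isCongruent (suc k) =
      CongruentGroup.isCongruent (A ⊗ᶜ record { rawGroup = ⌊ A ⌋ ^ k ; isCongruent = isCongruent k })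

  Vecᶜ : CongruentGroup → ℕ → CongruentGroup
  Vecᶜ A k = record
    { rawGroup = record
      { Carrier = Fin k → A.Carrier
      ; _≈_     = λ v w → ∀ i → v i A.≈ w i
      ; _∙_     = λ v w i → v i A.∙ w i
      ; ε       = λ _ → A.ε
      ; _⁻¹     = λ v i → v i A.⁻¹ }
    ; isCongruent = record
      { isEquivalence = record
        { refl  = λ _ → A.refl
        ; sym   = λ p i → A.sym (p i)
        ; trans = λ p q i → A.trans (p i) (q i) }
      ; ∙-cong  = λ p q i → A.∙-cong (p i) (q i)
      ; ⁻¹-cong = λ p i → A.⁻¹-cong (p i) } }
    where module A = CongruentGroup A

  record HomomorphicInverses (A B : CongruentGroup) : Set where
    private
      module A = CongruentGroup A
      module B = CongruentGroup B
    field
      to        : A.Carrier → B.Carrier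
      from      : B.Carrier → A.Carrier
      to-cong   : ∀ {x y} → x A.≈ y → to x B.≈ to y
      from-cong : ∀ {x y} → x B.≈ y → from x A.≈ from y
      to-∙      : ∀ x y → to (x A.∙ y) B.≈ (to x B.∙ to y)
      to-ε      : to A.ε B.≈ B.ε
      to-⁻¹     : ∀ x → to (x A.⁻¹) B.≈ (to x B.⁻¹)
      from-to   : ∀ x → from (to x) A.≈ x
      to-from   : ∀ y → to (from y) B.≈ y

  inverses⇒≃ : ∀ A B → HomomorphicInverses A B → A ≃ B
  inverses⇒≃ A B inv = to , record
    { isGroupMonomorphism = record
      { isGroupHomomorphism = record
        { isMonoidHomomorphism = record
          { isMagmaHomomorphism = record
            { isRelHomomorphism = record { cong = to-cong }
            ; homo = to-∙ }
          ; ε-homo = to-ε }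
        ; ⁻¹-homo = to-⁻¹ }
      ; injective = λ {x} {y} p → A.trans (A.sym (from-to x)) (A.trans (from-cong p) (from-to y)) }
    ; surjective = λ y → from y , λ p → B.trans (to-cong p) (to-from y) }
    where
    open HomomorphicInverses inv
    module A = CongruentGroup A
    module B = CongruentGroup B

  ≃⇒inverses : ∀ A B → A ≃ B → HomomorphicInverses A B
  ≃⇒inverses A B (f , iso) = record
    { to = f ; from = from ; to-cong = ⟦⟧-cong ; from-cong = from-cong
    ; to-∙ = ∙-homo ; to-ε = ε-homo ; to-⁻¹ = ⁻¹-homo
    ; from-to = λ x → injective (to-from (f x)) ; to-from = to-from }
    where
    open GroupMorphisms.IsGroupIsomorphism iso
    module A = CongruentGroup A
    module B = CongruentGroup B
    from : B.Carrier → A.Carrier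
    from y = proj₁ (surjective y)
    to-from : ∀ y → f (from y) B.≈ y
    to-from y = proj₂ (surjective y) A.refl
    from-cong : ∀ {x y} → x B.≈ y → from x A.≈ from y
    from-cong {x} {y} p = injective (B.trans (to-from x) (B.trans p (B.sym (to-from y))))

  ≃-refl : ∀ A → A ≃ A
  ≃-refl A = id , Identity.isGroupIsomorphism ⌊ A ⌋ (CongruentGroup.refl A)

  ≃-sym : ∀ A B → A ≃ B → B ≃ A
  ≃-sym A B iso = inverses⇒≃ B A record
    { to = from ; from = to ; to-cong = from-cong ; from-cong = to-cong
    ; to-∙ = λ x y → injective′ (B.trans (to-from _)
        (B.trans (B.∙-cong (B.sym (to-from x)) (B.sym (to-from y))) (B.sym (to-∙ (from x) (from y)))))
    ; to-ε = injective′ (B.trans (to-from _) (B.sym to-ε))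
    ; to-⁻¹ = λ x → injective′ (B.trans (to-from _)
        (B.trans (B.⁻¹-cong (B.sym (to-from x))) (B.sym (to-⁻¹ (from x)))))
    ; from-to = to-from ; to-from = from-to }
    where
    open HomomorphicInverses (≃⇒inverses A B iso)
    module A = CongruentGroup A
    module B = CongruentGroup B
    injective′ : ∀ {x y} → to x B.≈ to y → x A.≈ y
    injective′ = GroupMorphisms.IsGroupIsomorphism.injective (proj₂ iso)

  ≃-trans : ∀ A B C → A ≃ B → B ≃ C → A ≃ C
  ≃-trans A B C (f , f-iso) (g , g-iso) =
    _ , Composition.isGroupIsomorphism (CongruentGroup.trans C) f-iso g-iso

  ≃-setoid : Setoid (lsuc 0ℓ) 0ℓ
  ≃-setoid = record
    { Carrier = CongruentGroup
    ; _≈_ = _≃_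
    ; isEquivalence = record
      { refl  = λ {A} → ≃-refl A
      ; sym   = λ {A} {B} → ≃-sym A B
      ; trans = λ {A} {B} {C} → ≃-trans A B C } }

  module ≃-Reasoning = Relation.Binary.Reasoning.Setoid ≃-setoid

  ⊗-cong : ∀ A B C D → A ≃ C → B ≃ D → A ⊗ᶜ B ≃ C ⊗ᶜ D
  ⊗-cong A B C D A≃C B≃D = inverses⇒≃ (A ⊗ᶜ B) (C ⊗ᶜ D) record
    { to        = λ (x , y) → I.to x , J.to y
    ; from      = λ (x , y) → I.from x , J.from y
    ; to-cong   = λ (p , q) → I.to-cong p , J.to-cong q
    ; from-cong = λ (p , q) → I.from-cong p , J.from-cong q
    ; to-∙      = λ (x , y) (x′ , y′) → I.to-∙ x x′ , J.to-∙ y y′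
    ; to-ε      = I.to-ε , J.to-ε
    ; to-⁻¹     = λ (x , y) → I.to-⁻¹ x , J.to-⁻¹ y
    ; from-to   = λ (x , y) → I.from-to x , J.from-to y
    ; to-from   = λ (x , y) → I.to-from x , J.to-from y }
    where
    module I = HomomorphicInverses (≃⇒inverses A C A≃C)
    module J = HomomorphicInverses (≃⇒inverses B D B≃D)

  ⊗-congˡ : ∀ A B C → A ≃ B → A ⊗ᶜ C ≃ B ⊗ᶜ C
  ⊗-congˡ A B C A≃B = ⊗-cong A C B C A≃B (≃-refl C)

  ⊗-congʳ : ∀ A B C → B ≃ C → A ⊗ᶜ B ≃ A ⊗ᶜ C
  ⊗-congʳ A B C B≃C = ⊗-cong A B A C (≃-refl A) B≃C

  ⊗-assoc : ∀ A B C → (A ⊗ᶜ B) ⊗ᶜ C ≃ A ⊗ᶜ (B ⊗ᶜ C)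
  ⊗-assoc A B C = inverses⇒≃ ((A ⊗ᶜ B) ⊗ᶜ C) (A ⊗ᶜ (B ⊗ᶜ C)) record
    { to        = λ ((x , y) , z) → x , (y , z)
    ; from      = λ (x , (y , z)) → (x , y) , z
    ; to-cong   = λ ((p , q) , r) → p , (q , r)
    ; from-cong = λ (p , (q , r)) → (p , q) , r
    ; to-∙      = λ _ _ → R.refl
    ; to-ε      = R.refl
    ; to-⁻¹     = λ _ → R.refl
    ; from-to   = λ _ → L.refl
    ; to-from   = λ _ → R.refl }
    where
    module L = CongruentGroup ((A ⊗ᶜ B) ⊗ᶜ C)
    module R = CongruentGroup (A ⊗ᶜ (B ⊗ᶜ C))

  ⊗-identityˡ : ∀ A → trivialᶜ ⊗ᶜ A ≃ A
  ⊗-identityˡ A = inverses⇒≃ (trivialᶜ ⊗ᶜ A) A record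
    { to        = proj₂
    ; from      = λ x → tt , x
    ; to-cong   = proj₂
    ; from-cong = λ p → tt , p
    ; to-∙      = λ _ _ → A.refl
    ; to-ε      = A.refl
    ; to-⁻¹     = λ _ → A.refl
    ; from-to   = λ _ → tt , A.refl
    ; to-from   = λ _ → A.refl }
    where module A = CongruentGroup A

  ⊗-interchange : ∀ A B C D → (A ⊗ᶜ B) ⊗ᶜ (C ⊗ᶜ D) ≃ (A ⊗ᶜ C) ⊗ᶜ (B ⊗ᶜ D)
  ⊗-interchange A B C D = inverses⇒≃ ((A ⊗ᶜ B) ⊗ᶜ (C ⊗ᶜ D)) ((A ⊗ᶜ C) ⊗ᶜ (B ⊗ᶜ D)) record
    { to        = λ ((a , b) , (c , d)) → (a , c) , (b , d)
    ; from      = λ ((a , c) , (b , d)) → (a , b) , (c , d)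
    ; to-cong   = λ ((a , b) , (c , d)) → (a , c) , (b , d)
    ; from-cong = λ ((a , c) , (b , d)) → (a , b) , (c , d)
    ; to-∙      = λ _ _ → R.refl
    ; to-ε      = R.refl
    ; to-⁻¹     = λ _ → R.refl
    ; from-to   = λ _ → L.refl
    ; to-from   = λ _ → R.refl }
    where
    module L = CongruentGroup ((A ⊗ᶜ B) ⊗ᶜ (C ⊗ᶜ D))
    module R = CongruentGroup ((A ⊗ᶜ C) ⊗ᶜ (B ⊗ᶜ D))

  ^-+ : ∀ A m k → A ^ᶜ (m ℕ.+ k) ≃ A ^ᶜ m ⊗ᶜ A ^ᶜ k
  ^-+ A zero    k = ≃-sym (trivialᶜ ⊗ᶜ A ^ᶜ k) (A ^ᶜ k) (⊗-identityˡ (A ^ᶜ k))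
  ^-+ A (suc m) k = begin
    A ⊗ᶜ A ^ᶜ (m ℕ.+ k)         ≈⟨ ⊗-congʳ A (A ^ᶜ (m ℕ.+ k)) (A ^ᶜ m ⊗ᶜ A ^ᶜ k) (^-+ A m k) ⟩
    A ⊗ᶜ (A ^ᶜ m ⊗ᶜ A ^ᶜ k)     ≈⟨ ⊗-assoc A (A ^ᶜ m) (A ^ᶜ k) ⟨
    (A ⊗ᶜ A ^ᶜ m) ⊗ᶜ A ^ᶜ k     ∎
    where open ≃-Reasoning

  ^-cong : ∀ A B k → A ≃ B → A ^ᶜ k ≃ B ^ᶜ k
  ^-cong A B zero    A≃B = ≃-refl trivialᶜ
  ^-cong A B (suc k) A≃B = ⊗-cong A (A ^ᶜ k) B (B ^ᶜ k) A≃B (^-cong A B k A≃B)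

  ^-distrib-⊗ : ∀ A B k → (A ⊗ᶜ B) ^ᶜ k ≃ A ^ᶜ k ⊗ᶜ B ^ᶜ k
  ^-distrib-⊗ A B zero    = ≃-sym (trivialᶜ ⊗ᶜ trivialᶜ) trivialᶜ (⊗-identityˡ trivialᶜ)
  ^-distrib-⊗ A B (suc k) = begin
    (A ⊗ᶜ B) ⊗ᶜ (A ⊗ᶜ B) ^ᶜ k
      ≈⟨ ⊗-congʳ (A ⊗ᶜ B) ((A ⊗ᶜ B) ^ᶜ k) (A ^ᶜ k ⊗ᶜ B ^ᶜ k) (^-distrib-⊗ A B k) ⟩
    (A ⊗ᶜ B) ⊗ᶜ (A ^ᶜ k ⊗ᶜ B ^ᶜ k)   ≈⟨ ⊗-interchange A B (A ^ᶜ k) (B ^ᶜ k) ⟩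
    (A ⊗ᶜ A ^ᶜ k) ⊗ᶜ (B ⊗ᶜ B ^ᶜ k)   ∎
    where open ≃-Reasoning

  ^-split : ∀ A {m k} → m ℕ.≤ k → A ^ᶜ k ≃ A ^ᶜ m ⊗ᶜ A ^ᶜ (k ℕ.∸ m)
  ^-split A {m} {k} m≤k =
    subst (λ z → A ^ᶜ z ≃ A ^ᶜ m ⊗ᶜ A ^ᶜ (k ℕ.∸ m)) (ℕ.m+[n∸m]≡n m≤k) (^-+ A m (k ℕ.∸ m))

  Vec≃^ : ∀ A k → Vecᶜ A k ≃ A ^ᶜ k
  Vec≃^ A zero = inverses⇒≃ (Vecᶜ A zero) trivialᶜ record
    { to = λ _ → tt ; from = λ _ () ; to-cong = λ _ → tt ; from-cong = λ _ ()
    ; to-∙ = λ _ _ → tt ; to-ε = tt ; to-⁻¹ = λ _ → tt ; from-to = λ _ () ; to-from = λ _ → tt }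
  Vec≃^ A (suc k) = begin
    Vecᶜ A (suc k)      ≈⟨ head-tail ⟩
    A ⊗ᶜ Vecᶜ A k       ≈⟨ ⊗-congʳ A (Vecᶜ A k) (A ^ᶜ k) (Vec≃^ A k) ⟩
    A ⊗ᶜ A ^ᶜ k         ∎
    where
    open ≃-Reasoning
    module A = CongruentGroup A
    cons : A.Carrier × (Fin k → A.Carrier) → Fin (suc k) → A.Carrier
    cons (x , v) Fin.zero    = x
    cons (x , v) (Fin.suc i) = v i
    head-tail : Vecᶜ A (suc k) ≃ A ⊗ᶜ Vecᶜ A k
    head-tail = inverses⇒≃ (Vecᶜ A (suc k)) (A ⊗ᶜ Vecᶜ A k) record
      { to        = λ v → v Fin.zero , λ i → v (Fin.suc i)
      ; from      = cons
      ; to-cong   = λ p → p Fin.zero , λ i → p (Fin.suc i)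
      ; from-cong = λ { (p , q) Fin.zero → p ; (p , q) (Fin.suc i) → q i }
      ; to-∙      = λ _ _ → A.refl , λ _ → A.refl
      ; to-ε      = A.refl , λ _ → A.refl
      ; to-⁻¹     = λ _ → A.refl , λ _ → A.refl
      ; from-to   = λ { v Fin.zero → A.refl ; v (Fin.suc i) → A.refl }
      ; to-from   = λ _ → A.refl , λ _ → A.refl }

  ^-⊗-cong : ∀ A B C D k → A ⊗ᶜ B ≃ C ⊗ᶜ D → A ^ᶜ k ⊗ᶜ B ^ᶜ k ≃ C ^ᶜ k ⊗ᶜ D ^ᶜ k
  ^-⊗-cong A B C D k A⊗B≃C⊗D = begin
    A ^ᶜ k ⊗ᶜ B ^ᶜ k      ≈⟨ ^-distrib-⊗ A B k ⟨
    (A ⊗ᶜ B) ^ᶜ k         ≈⟨ ^-cong (A ⊗ᶜ B) (C ⊗ᶜ D) k A⊗B≃C⊗D ⟩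
    (C ⊗ᶜ D) ^ᶜ k         ≈⟨ ^-distrib-⊗ C D k ⟩
    C ^ᶜ k ⊗ᶜ D ^ᶜ k      ∎
    where open ≃-Reasoning

  module _ (A B C D Z : CongruentGroup) (A⊗B≃C⊗D : A ⊗ᶜ B ≃ C ⊗ᶜ D) {k m} (k≤m : k ℕ.≤ m) where
    open ≃-Reasoning
    private
      Aᵏ Bᵏ Cᵏ Dᵏ Aˢ Bˢ : CongruentGroup
      Aᵏ = A ^ᶜ k
      Bᵏ = B ^ᶜ k
      Cᵏ = C ^ᶜ k
      Dᵏ = D ^ᶜ k
      Aˢ = A ^ᶜ (m ℕ.∸ k)
      Bˢ = B ^ᶜ (m ℕ.∸ k)
      pairs : Aᵏ ⊗ᶜ Bᵏ ≃ Cᵏ ⊗ᶜ Dᵏ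
      pairs = ^-⊗-cong A B C D k A⊗B≃C⊗D

    pair-off-surplusˡ : A ^ᶜ m ⊗ᶜ Bᵏ ⊗ᶜ Z ≃ Cᵏ ⊗ᶜ Aˢ ⊗ᶜ Dᵏ ⊗ᶜ Z
    pair-off-surplusˡ = begin
      A ^ᶜ m ⊗ᶜ (Bᵏ ⊗ᶜ Z)            ≈⟨ ⊗-congˡ (A ^ᶜ m) (Aᵏ ⊗ᶜ Aˢ) (Bᵏ ⊗ᶜ Z) (^-split A k≤m) ⟩
      (Aᵏ ⊗ᶜ Aˢ) ⊗ᶜ (Bᵏ ⊗ᶜ Z)        ≈⟨ ⊗-interchange Aᵏ Aˢ Bᵏ Z ⟩
      (Aᵏ ⊗ᶜ Bᵏ) ⊗ᶜ (Aˢ ⊗ᶜ Z)        ≈⟨ ⊗-congˡ (Aᵏ ⊗ᶜ Bᵏ) (Cᵏ ⊗ᶜ Dᵏ) (Aˢ ⊗ᶜ Z) pairs ⟩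
      (Cᵏ ⊗ᶜ Dᵏ) ⊗ᶜ (Aˢ ⊗ᶜ Z)        ≈⟨ ⊗-interchange Cᵏ Dᵏ Aˢ Z ⟩
      (Cᵏ ⊗ᶜ Aˢ) ⊗ᶜ (Dᵏ ⊗ᶜ Z)        ≈⟨ ⊗-assoc Cᵏ Aˢ (Dᵏ ⊗ᶜ Z) ⟩
      Cᵏ ⊗ᶜ (Aˢ ⊗ᶜ (Dᵏ ⊗ᶜ Z))        ∎

    pair-off-surplusʳ : Aᵏ ⊗ᶜ B ^ᶜ m ⊗ᶜ Z ≃ Cᵏ ⊗ᶜ Bˢ ⊗ᶜ Dᵏ ⊗ᶜ Z
    pair-off-surplusʳ = begin
      Aᵏ ⊗ᶜ (B ^ᶜ m ⊗ᶜ Z)            ≈⟨ ⊗-congʳ Aᵏ (B ^ᶜ m ⊗ᶜ Z) ((Bᵏ ⊗ᶜ Bˢ) ⊗ᶜ Z)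
                                          (⊗-congˡ (B ^ᶜ m) (Bᵏ ⊗ᶜ Bˢ) Z (^-split B k≤m)) ⟩
      Aᵏ ⊗ᶜ ((Bᵏ ⊗ᶜ Bˢ) ⊗ᶜ Z)        ≈⟨ ⊗-congʳ Aᵏ ((Bᵏ ⊗ᶜ Bˢ) ⊗ᶜ Z) (Bᵏ ⊗ᶜ (Bˢ ⊗ᶜ Z)) (⊗-assoc Bᵏ Bˢ Z) ⟩
      Aᵏ ⊗ᶜ (Bᵏ ⊗ᶜ (Bˢ ⊗ᶜ Z))        ≈⟨ ⊗-assoc Aᵏ Bᵏ (Bˢ ⊗ᶜ Z) ⟨
      (Aᵏ ⊗ᶜ Bᵏ) ⊗ᶜ (Bˢ ⊗ᶜ Z)        ≈⟨ ⊗-congˡ (Aᵏ ⊗ᶜ Bᵏ) (Cᵏ ⊗ᶜ Dᵏ) (Bˢ ⊗ᶜ Z) pairs ⟩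
      (Cᵏ ⊗ᶜ Dᵏ) ⊗ᶜ (Bˢ ⊗ᶜ Z)        ≈⟨ ⊗-interchange Cᵏ Dᵏ Bˢ Z ⟩
      (Cᵏ ⊗ᶜ Bˢ) ⊗ᶜ (Dᵏ ⊗ᶜ Z)        ≈⟨ ⊗-assoc Cᵏ Bˢ (Dᵏ ⊗ᶜ Z) ⟩
      Cᵏ ⊗ᶜ (Bˢ ⊗ᶜ (Dᵏ ⊗ᶜ Z))        ∎

  -- Congruences modulo m and the Chinese remainder theorem

  infix 4 _≡_[mod_]
  record _≡_[mod_] (x y : ℤ) (m : ℕ) : Set where
    constructor mod
    field
      m∣x-y : + m ∣ x - y

  ≡⇒≡[mod] : ∀ {m x y} → x ≡ y → x ≡ y [mod m ]
  ≡⇒≡[mod] {m} {x} refl = mod (divides (+ 0) (trans (ℤ.+-inverseʳ x) (sym (ℤ.*-zeroˡ (+ m)))))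

  ≈⇒≡[mod] : ∀ m {x y} → RawGroup._≈_ (ℤmod m) x y → x ≡ y [mod m ]
  ≈⇒≡[mod] m {x} {y} p = mod (∣.∣ᵤ⇒∣ {+ m} {x - y} p)

  ≡[mod]⇒≈ : ∀ m {x y} → x ≡ y [mod m ] → RawGroup._≈_ (ℤmod m) x y
  ≡[mod]⇒≈ m {x} {y} (mod p) = ∣.∣⇒∣ᵤ {+ m} {x - y} p

  module _ {m : ℕ} where

    ≡[mod]-sym : ∀ {x y} → x ≡ y [mod m ] → y ≡ x [mod m ]
    ≡[mod]-sym {x} {y} (mod p) = mod (subst (+ m ∣_) (eq x y) (∣.∣m⇒∣-m p))
      where
      eq : ∀ x y → - (x - y) ≡ y - x
      eq = solve-∀

    ≡[mod]-trans : ∀ {x y z} → x ≡ y [mod m ] → y ≡ z [mod m ] → x ≡ z [mod m ]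
    ≡[mod]-trans {x} {y} {z} (mod p) (mod q) = mod (subst (+ m ∣_) (eq x y z) (∣.∣m∣n⇒∣m+n p q))
      where
      eq : ∀ x y z → (x - y) + (y - z) ≡ x - z
      eq = solve-∀

    ≡[mod]-+ : ∀ {x y u v} → x ≡ y [mod m ] → u ≡ v [mod m ] → x + u ≡ y + v [mod m ]
    ≡[mod]-+ {x} {y} {u} {v} (mod p) (mod q) = mod (subst (+ m ∣_) (eq x y u v) (∣.∣m∣n⇒∣m+n p q))
      where
      eq : ∀ x y u v → (x - y) + (u - v) ≡ (x + u) - (y + v)
      eq = solve-∀

    ≡[mod]-neg : ∀ {x y} → x ≡ y [mod m ] → - x ≡ - y [mod m ]
    ≡[mod]-neg {x} {y} (mod p) = mod (subst (+ m ∣_) (eq x y) (∣.∣m⇒∣-m p))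
      where
      eq : ∀ x y → - (x - y) ≡ - x - - y
      eq = solve-∀

  ℤmodᶜ : ℕ → CongruentGroup
  ℤmodᶜ m = record
    { rawGroup    = ℤmod m
    ; isCongruent = record
      { isEquivalence = record
        { refl  = λ {x} → ≡[mod]⇒≈ m (≡⇒≡[mod] {m} {x} refl)
        ; sym   = λ {x} {y} p → ≡[mod]⇒≈ m (≡[mod]-sym (≈⇒≡[mod] m {x} {y} p))
        ; trans = λ {x} {y} {z} p q →
            ≡[mod]⇒≈ m (≡[mod]-trans (≈⇒≡[mod] m {x} {y} p) (≈⇒≡[mod] m {y} {z} q)) }
      ; ∙-cong  = λ {x} {y} {u} {v} p q →
          ≡[mod]⇒≈ m (≡[mod]-+ (≈⇒≡[mod] m {x} {y} p) (≈⇒≡[mod] m {u} {v} q))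
      ; ⁻¹-cong = λ {x} {y} p → ≡[mod]⇒≈ m (≡[mod]-neg (≈⇒≡[mod] m {x} {y} p)) } }

  record GcdLcmCofactors (b c g l : ℕ) : Set where
    field
      β γ s t : ℤ
      b≡βg    : + b ≡ β * + g
      c≡γg    : + c ≡ γ * + g
      l≡βc    : + l ≡ β * + c
      l≡γb    : + l ≡ γ * + b
      sβ+tγ≡1 : s * β + t * γ ≡ + 1

  ℤ-bézout : ∀ m n → ∃₂ λ s t → s * + m + t * + n ≡ + gcd m n
  ℤ-bézout m n with Bézout.identity (gcd-GCD m n)
  ... | Bézout.+- x y eq = + x , - + y ,
    trans (cong (λ z → z + - + y * + n) (sym (lift eq))) (cancel (+ gcd m n) (+ y) (+ n))
    where
    lift : gcd m n ℕ.+ y ℕ.* n ≡ x ℕ.* m → + gcd m n + + y * + n ≡ + x * + m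
    lift eq = trans (cong (λ z → + gcd m n + z) (sym (ℤ.pos-* y n)))
      (trans (sym (ℤ.pos-+ (gcd m n) (y ℕ.* n))) (trans (cong +_ eq) (ℤ.pos-* x m)))
    cancel : ∀ d y n → (d + y * n) + - y * n ≡ d
    cancel = solve-∀
  ... | Bézout.-+ x y eq = - + x , + y ,
    trans (cong (λ z → - + x * + m + z) (sym (lift eq))) (cancel (+ gcd m n) (+ x) (+ m))
    where
    lift : gcd m n ℕ.+ x ℕ.* m ≡ y ℕ.* n → + gcd m n + + x * + m ≡ + y * + n
    lift eq = trans (cong (λ z → + gcd m n + z) (sym (ℤ.pos-* x m)))
      (trans (sym (ℤ.pos-+ (gcd m n) (x ℕ.* m))) (trans (cong +_ eq) (ℤ.pos-* y n)))
    cancel : ∀ d x m → - x * m + (d + x * m) ≡ d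
    cancel = solve-∀

  gcdLcmCofactors : ∀ b c .{{_ : NonZero b}} → GcdLcmCofactors b c (gcd b c) (lcm b c)
  gcdLcmCofactors b c = record
    { β = + β ; γ = + γ ; s = s ; t = t
    ; b≡βg = lift β g b≡βg ; c≡γg = lift γ g c≡γg ; l≡βc = lift β c l≡βc ; l≡γb = lift γ b l≡γb
    ; sβ+tγ≡1 = ℤ.*-cancelʳ-≡ _ _ (+ g) (begin
        (s * + β + t * + γ) * + g        ≡⟨ distrib s t (+ β) (+ γ) (+ g) ⟩
        s * (+ β * + g) + t * (+ γ * + g) ≡⟨ cong₂ (λ u v → s * u + t * v) (sym (lift β g b≡βg)) (sym (lift γ g c≡γg)) ⟩
        s * + b + t * + c                ≡⟨ sb+tc≡g ⟩
        + g                              ≡⟨ ℤ.*-identityˡ (+ g) ⟨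
        + 1 * + g                        ∎) }
    where
    open ≡.≡-Reasoning
    g = gcd b c
    instance
      g≢0 : NonZero g
      g≢0 = ℕ.≢-nonZero (gcd[m,n]≢0 b c (inj₁ (ℕ.≢-nonZero⁻¹ b)))
    β = ℕ._∣_.quotient (gcd[m,n]∣m b c)
    γ = ℕ._∣_.quotient (gcd[m,n]∣n b c)
    b≡βg : b ≡ β ℕ.* g
    b≡βg = ℕ._∣_.equality (gcd[m,n]∣m b c)
    c≡γg : c ≡ γ ℕ.* g
    c≡γg = ℕ._∣_.equality (gcd[m,n]∣n b c)
    l≡βc : lcm b c ≡ β ℕ.* c
    l≡βc = ℕ.*-cancelˡ-≡ _ _ g (begin
      g ℕ.* lcm b c       ≡⟨ gcd*lcm b c ⟩
      b ℕ.* c             ≡⟨ cong (ℕ._* c) b≡βg ⟩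
      β ℕ.* g ℕ.* c       ≡⟨ cong (ℕ._* c) (ℕ.*-comm β g) ⟩
      g ℕ.* β ℕ.* c       ≡⟨ ℕ.*-assoc g β c ⟩
      g ℕ.* (β ℕ.* c)     ∎)
    l≡γb : lcm b c ≡ γ ℕ.* b
    l≡γb = ℕ.*-cancelˡ-≡ _ _ g (begin
      g ℕ.* lcm b c       ≡⟨ gcd*lcm b c ⟩
      b ℕ.* c             ≡⟨ cong (b ℕ.*_) c≡γg ⟩
      b ℕ.* (γ ℕ.* g)     ≡⟨ ℕ.*-comm b (γ ℕ.* g) ⟩
      γ ℕ.* g ℕ.* b       ≡⟨ cong (ℕ._* b) (ℕ.*-comm γ g) ⟩
      g ℕ.* γ ℕ.* b       ≡⟨ ℕ.*-assoc g γ b ⟩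
      g ℕ.* (γ ℕ.* b)     ∎)
    lift : ∀ {m} p q → m ≡ p ℕ.* q → + m ≡ + p * + q
    lift p q eq = trans (cong +_ eq) (ℤ.pos-* p q)
    s = proj₁ (ℤ-bézout b c)
    t = proj₁ (proj₂ (ℤ-bézout b c))
    sb+tc≡g : s * + b + t * + c ≡ + g
    sb+tc≡g = proj₂ (proj₂ (ℤ-bézout b c))
    distrib : ∀ s t β γ g → (s * β + t * γ) * g ≡ s * (β * g) + t * (γ * g)
    distrib = solve-∀

  module ChineseRemainder {b c g l} (cofactors : GcdLcmCofactors b c g l) where
    open GcdLcmCofactors cofactors

    form : ℤ → ℤ → ℤ × ℤ → ℤ
    form p q (x , y) = p * x + q * y

    form-cong : ∀ {m} p q {x y x′ y′} → + m ∣ p * (x - x′) → + m ∣ q * (y - y′) →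
                RawGroup._≈_ (ℤmod m) (form p q (x , y)) (form p q (x′ , y′))
    form-cong {m} p q {x} {y} {x′} {y′} m∣px m∣qy =
      ≡[mod]⇒≈ m {form p q (x , y)} {form p q (x′ , y′)}
        (mod (subst (+ m ∣_) (eq p q x y x′ y′) (∣.∣m∣n⇒∣m+n m∣px m∣qy)))
      where
      eq : ∀ p q x y x′ y′ → p * (x - x′) + q * (y - y′) ≡ (p * x + q * y) - (p * x′ + q * y′)
      eq = solve-∀

    private
      via-factor : ∀ {m k d} a → + m ≡ a * + k → + k ∣ d → + m ∣ a * d
      via-factor {d = d} a m≡ak k∣d = subst (_∣ a * d) (sym m≡ak) (∣.*-monoʳ-∣ a k∣d)

      via-multiple : ∀ {m k d} a → + m ∣ + k → + k ∣ d → + m ∣ a * d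
      via-multiple a m∣k k∣d = ∣.∣n⇒∣m*n a (∣.∣-trans m∣k k∣d)

      negate : ∀ {m} a {d} → + m ∣ a * d → + m ∣ (- a) * d
      negate {m} a {d} m∣ad = subst (+ m ∣_) (ℤ.neg-distribˡ-* a d) (∣.∣m⇒∣-m m∣ad)

      g∣b : + g ∣ + b
      g∣b = divides β b≡βg
      g∣c : + g ∣ + c
      g∣c = divides γ c≡γg
      b∣l : + b ∣ + l
      b∣l = divides γ l≡γb
      c∣l : + c ∣ + l
      c∣l = divides β l≡βc

      form-+ : ∀ p q x y x′ y′ → p * (x + x′) + q * (y + y′) ≡ (p * x + q * y) + (p * x′ + q * y′)
      form-+ = solve-∀
      form-0 : ∀ p q → p * + 0 + q * + 0 ≡ + 0
      form-0 = solve-∀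
      form-neg : ∀ p q x y → p * (- x) + q * (- y) ≡ - (p * x + q * y)
      form-neg = solve-∀

      unit : ∀ x → x * (s * β + t * γ) ≡ x
      unit x = trans (cong (x *_) sβ+tγ≡1) (ℤ.*-identityʳ x)
      from-to₁ : ∀ s t β γ x y → β * (s * x + t * y) + t * (γ * x + (- β) * y) ≡ x * (s * β + t * γ)
      from-to₁ = solve-∀
      from-to₂ : ∀ s t β γ x y → γ * (s * x + t * y) + (- s) * (γ * x + (- β) * y) ≡ y * (s * β + t * γ)
      from-to₂ = solve-∀
      to-from₁ : ∀ s t β γ x y → s * (β * x + t * y) + t * (γ * x + (- s) * y) ≡ x * (s * β + t * γ)
      to-from₁ = solve-∀
      to-from₂ : ∀ s t β γ x y → γ * (β * x + t * y) + (- β) * (γ * x + (- s) * y) ≡ y * (s * β + t * γ)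
      to-from₂ = solve-∀

    -- (x , y) ↦ (s x + t y , γ x − β y) and (X , Y) ↦ (β X + t Y , γ X − s Y) are inverse because
    -- s β + t γ = 1; they respect the congruences because g ∣ b, g ∣ c, l = β c = γ b.
    crt : ℤmodᶜ b ⊗ᶜ ℤmodᶜ c ≃ ℤmodᶜ g ⊗ᶜ ℤmodᶜ l
    crt = inverses⇒≃ (ℤmodᶜ b ⊗ᶜ ℤmodᶜ c) (ℤmodᶜ g ⊗ᶜ ℤmodᶜ l) record
      { to        = λ v → form s t v , form γ (- β) v
      ; from      = λ w → form β t w , form γ (- s) w
      ; to-cong   = λ {(x , y)} {(x′ , y′)} (p , q) →
          let mod x≡x′ = ≈⇒≡[mod] b {x} {x′} p ; mod y≡y′ = ≈⇒≡[mod] c {y} {y′} q in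
          form-cong s t (via-multiple s g∣b x≡x′) (via-multiple t g∣c y≡y′) ,
          form-cong γ (- β) (via-factor γ l≡γb x≡x′) (negate β (via-factor β l≡βc y≡y′))
      ; from-cong = λ {(x , y)} {(x′ , y′)} (p , q) →
          let mod x≡x′ = ≈⇒≡[mod] g {x} {x′} p ; mod y≡y′ = ≈⇒≡[mod] l {y} {y′} q in
          form-cong β t (via-factor β b≡βg x≡x′) (via-multiple t b∣l y≡y′) ,
          form-cong γ (- s) (via-factor γ c≡γg x≡x′) (via-multiple (- s) c∣l y≡y′)
      ; to-∙      = λ (x , y) (x′ , y′) →
          reflexive g (form-+ s t x y x′ y′) , reflexive l (form-+ γ (- β) x y x′ y′)
      ; to-ε      = reflexive g (form-0 s t) , reflexive l (form-0 γ (- β))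
      ; to-⁻¹     = λ (x , y) → reflexive g (form-neg s t x y) , reflexive l (form-neg γ (- β) x y)
      ; from-to   = λ (x , y) →
          reflexive b (trans (from-to₁ s t β γ x y) (unit x)) ,
          reflexive c (trans (from-to₂ s t β γ x y) (unit y))
      ; to-from   = λ (x , y) →
          reflexive g (trans (to-from₁ s t β γ x y) (unit x)) ,
          reflexive l (trans (to-from₂ s t β γ x y) (unit y)) }
      where
      reflexive : ∀ m {x y} → x ≡ y → RawGroup._≈_ (ℤmod m) x y
      reflexive m = CongruentGroup.reflexive (ℤmodᶜ m)

  Σℤ-cong : ∀ {n} {f g : Fin n → ℤ} → (∀ i → f i ≡ g i) → Σℤ f ≡ Σℤ g
  Σℤ-cong {zero}  f≡g = refl
  Σℤ-cong {suc n} f≡g = cong₂ _+_ (f≡g zero) (Σℤ-cong (f≡g ∘ suc))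

  Σℤ-+ : ∀ {n} (f g : Fin n → ℤ) → Σℤ (λ i → f i + g i) ≡ Σℤ f + Σℤ g
  Σℤ-+ {zero}  f g = refl
  Σℤ-+ {suc n} f g = trans (cong (_+_ (f zero + g zero)) (Σℤ-+ (f ∘ suc) (g ∘ suc)))
    (interchange (f zero) (g zero) (Σℤ (f ∘ suc)) (Σℤ (g ∘ suc)))
    where
    interchange : ∀ a b c d → (a + b) + (c + d) ≡ (a + c) + (b + d)
    interchange = solve-∀

  Σℤ-* : ∀ {n} k (f : Fin n → ℤ) → Σℤ (λ i → k * f i) ≡ k * Σℤ f
  Σℤ-* {zero}  k f = sym (ℤ.*-zeroʳ k)
  Σℤ-* {suc n} k f = trans (cong (_+_ (k * f zero)) (Σℤ-* k (f ∘ suc)))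
    (sym (ℤ.*-distribˡ-+ k (f zero) (Σℤ (f ∘ suc))))

  Σℤ-neg : ∀ {n} (f : Fin n → ℤ) → Σℤ (λ i → - f i) ≡ - Σℤ f
  Σℤ-neg {zero}  f = refl
  Σℤ-neg {suc n} f = trans (cong (_+_ (- f zero)) (Σℤ-neg (f ∘ suc)))
    (sym (ℤ.neg-distrib-+ (f zero) (Σℤ (f ∘ suc))))

  Σℤ-- : ∀ {n} (f g : Fin n → ℤ) → Σℤ (λ i → f i - g i) ≡ Σℤ f - Σℤ g
  Σℤ-- f g = trans (Σℤ-+ f (λ i → - g i)) (cong (_+_ (Σℤ f)) (Σℤ-neg g))

  Σℤ-const : ∀ {n} x → Σℤ {n} (λ _ → x) ≡ + n * x
  Σℤ-const {zero}  x = sym (ℤ.*-zeroˡ x)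
  Σℤ-const {suc n} x = trans (cong (_+_ x) (Σℤ-const {n} x)) (sym (ℤ.suc-* (+ n) x))

  Σℤ-zero : ∀ {n} → Σℤ {n} (λ _ → + 0) ≡ + 0
  Σℤ-zero {n} = trans (Σℤ-const {n} (+ 0)) (ℤ.*-zeroʳ (+ n))

  Σℕ⇒Σℤ : ∀ {n} (f : Fin n → ℕ) → + Σℕ f ≡ Σℤ (λ i → + f i)
  Σℕ⇒Σℤ {zero}  f = refl
  Σℕ⇒Σℤ {suc n} f = trans (ℤ.pos-+ (f zero) (Σℕ (f ∘ suc))) (cong (_+_ (+ f zero)) (Σℕ⇒Σℤ (f ∘ suc)))

  Σℤ-single : ∀ {n} (j : Fin n) (f : Fin n → ℤ) → (∀ i → i ≢ j → f i ≡ + 0) → Σℤ f ≡ f j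
  Σℤ-single {suc n} zero f f≡0 =
    trans (cong (_+_ (f zero)) (trans (Σℤ-cong (λ i → f≡0 (suc i) λ ())) (Σℤ-zero {n}))) (ℤ.+-identityʳ (f zero))
  Σℤ-single {suc n} (suc j) f f≡0 =
    trans (cong (λ z → z + Σℤ (f ∘ suc)) (f≡0 zero λ ()))
      (trans (ℤ.+-identityˡ _) (Σℤ-single j (f ∘ suc) (λ i i≢j → f≡0 (suc i) (i≢j ∘ suc-injective))))

  -- Enumerating the three layers

  -- layerSize by recursion on the vertices, so that it computes once the layer of vertex zero is known.
  layerCount : ∀ {n t} → (Fin n → Fin t) → Fin t → ℕ
  layerCount {zero}  l k = 0
  layerCount {suc n} l k = (if does (l zero ≟ k) then suc else id) (layerCount (l ∘ suc) k)

  layerSize≡layerCount : ∀ {n t} (l : Fin n → Fin t) k → layerSize l k ≡ layerCount l k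
  layerSize≡layerCount l k = count-tabulate id
    where
    count-tabulate : ∀ {m} (h : Fin m → Fin _) →
                     count (λ v → l v ≟ k) (tabulate h) ≡ layerCount (l ∘ h) k
    count-tabulate {zero}  h = refl
    count-tabulate {suc m} h = cong (if does (l (h zero) ≟ k) then suc else id) (count-tabulate (h ∘ suc))

  Layers : ℕ → ℕ → ℕ → Set
  Layers a b c = Fin a ⊎ (Fin b ⊎ Fin c)

  layerOf : ∀ {a b c} → Layers a b c → Fin 3
  layerOf (inj₁ _)        = zero
  layerOf (inj₂ (inj₁ _)) = suc zero
  layerOf (inj₂ (inj₂ _)) = suc (suc zero)

  record LayerEnumeration {n} (l : Fin n → Fin 3) (a b c : ℕ) : Set where
    field
      embed       : Layers a b c → Fin n
      view        : Fin n → Layers a b c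
      view-embed  : ∀ x → view (embed x) ≡ x
      embed-view  : ∀ v → embed (view v) ≡ v
      layer-embed : ∀ x → l (embed x) ≡ layerOf x
      Σℤ-layers   : ∀ f → Σℤ f ≡ Σℤ (f ∘ embed ∘ inj₁) + Σℤ (f ∘ embed ∘ inj₂ ∘ inj₁)
                                  + Σℤ (f ∘ embed ∘ inj₂ ∘ inj₂)

    e₁ : Fin a → Fin n
    e₁ = embed ∘ inj₁
    e₂ : Fin b → Fin n
    e₂ = embed ∘ inj₂ ∘ inj₁
    e₃ : Fin c → Fin n
    e₃ = embed ∘ inj₂ ∘ inj₂

    layered : (Fin a → ℤ) → (Fin b → ℤ) → (Fin c → ℤ) → Fin n → ℤ
    layered x y z v with view v
    ... | inj₁ i        = x i
    ... | inj₂ (inj₁ j) = y j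
    ... | inj₂ (inj₂ k) = z k

    layered-e₁ : ∀ x y z i → layered x y z (e₁ i) ≡ x i
    layered-e₁ x y z i rewrite view-embed (inj₁ i) = refl
    layered-e₂ : ∀ x y z i → layered x y z (e₂ i) ≡ y i
    layered-e₂ x y z i rewrite view-embed (inj₂ (inj₁ i)) = refl
    layered-e₃ : ∀ x y z i → layered x y z (e₃ i) ≡ z i
    layered-e₃ x y z i rewrite view-embed (inj₂ (inj₂ i)) = refl

    layered-cong : ∀ {x x′ y y′ z z′} → (∀ i → x i ≡ x′ i) → (∀ j → y j ≡ y′ j) → (∀ k → z k ≡ z′ k) →
                   ∀ v → layered x y z v ≡ layered x′ y′ z′ v
    layered-cong x≡ y≡ z≡ v with view v
    ... | inj₁ i        = x≡ i
    ... | inj₂ (inj₁ j) = y≡ j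
    ... | inj₂ (inj₂ k) = z≡ k

    layered-minus : ∀ x x′ y y′ z z′ v →
      layered x y z v - layered x′ y′ z′ v ≡ layered (λ i → x i - x′ i) (λ j → y j - y′ j) (λ k → z k - z′ k) v
    layered-minus x x′ y y′ z z′ v with view v
    ... | inj₁ i        = refl
    ... | inj₂ (inj₁ j) = refl
    ... | inj₂ (inj₂ k) = refl

    by-layer : (P : Fin n → Set) → (∀ i → P (e₁ i)) → (∀ j → P (e₂ j)) → (∀ k → P (e₃ k)) → ∀ v → P v
    by-layer P h₁ h₂ h₃ v with view v | embed-view v
    ... | inj₁ i        | eq = subst P eq (h₁ i)
    ... | inj₂ (inj₁ j) | eq = subst P eq (h₂ j)
    ... | inj₂ (inj₂ k) | eq = subst P eq (h₃ k)

  module _ {n} {l : Fin (suc n) → Fin 3} {a b c} (E : LayerEnumeration (l ∘ suc) a b c) where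
    private
      module E = LayerEnumeration E
      Σ₁ Σ₂ Σ₃ : (Fin (suc n) → ℤ) → ℤ
      Σ₁ f = Σℤ (f ∘ suc ∘ E.e₁)
      Σ₂ f = Σℤ (f ∘ suc ∘ E.e₂)
      Σ₃ f = Σℤ (f ∘ suc ∘ E.e₃)
      Σℤ-suc : ∀ f → Σℤ f ≡ f zero + (Σ₁ f + Σ₂ f + Σ₃ f)
      Σℤ-suc f = cong (_+_ (f zero)) (E.Σℤ-layers (f ∘ suc))

    push₁ : l zero ≡ zero → LayerEnumeration l (suc a) b c
    push₁ l₀ = record
      { embed = embed ; view = view ; view-embed = view-embed ; embed-view = embed-view
      ; layer-embed = layer-embed
      ; Σℤ-layers = λ f → trans (Σℤ-suc f) (assoc (f zero) (Σ₁ f) (Σ₂ f) (Σ₃ f)) }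
      where
      embed : Layers (suc a) b c → Fin (suc n)
      embed (inj₁ zero)    = zero
      embed (inj₁ (suc i)) = suc (E.embed (inj₁ i))
      embed (inj₂ y)       = suc (E.embed (inj₂ y))
      view : Fin (suc n) → Layers (suc a) b c
      view zero    = inj₁ zero
      view (suc v) = map₁ suc (E.view v)
      view-embed : ∀ x → view (embed x) ≡ x
      view-embed (inj₁ zero)    = refl
      view-embed (inj₁ (suc i)) = cong (map₁ suc) (E.view-embed (inj₁ i))
      view-embed (inj₂ y)       = cong (map₁ suc) (E.view-embed (inj₂ y))
      embed-view : ∀ v → embed (view v) ≡ v
      embed-view zero = refl
      embed-view (suc v) with E.view v | E.embed-view v
      ... | inj₁ i | eq = cong suc eq
      ... | inj₂ y | eq = cong suc eq
      layer-embed : ∀ x → l (embed x) ≡ layerOf x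
      layer-embed (inj₁ zero)     = l₀
      layer-embed (inj₁ (suc i))  = E.layer-embed (inj₁ i)
      layer-embed (inj₂ (inj₁ j)) = E.layer-embed (inj₂ (inj₁ j))
      layer-embed (inj₂ (inj₂ k)) = E.layer-embed (inj₂ (inj₂ k))
      assoc : ∀ x p q r → x + (p + q + r) ≡ (x + p) + q + r
      assoc = solve-∀

    push₂ : l zero ≡ suc zero → LayerEnumeration l a (suc b) c
    push₂ l₀ = record
      { embed = embed ; view = view ; view-embed = view-embed ; embed-view = embed-view
      ; layer-embed = layer-embed
      ; Σℤ-layers = λ f → trans (Σℤ-suc f) (assoc (f zero) (Σ₁ f) (Σ₂ f) (Σ₃ f)) }
      where
      embed : Layers a (suc b) c → Fin (suc n)
      embed (inj₂ (inj₁ zero))    = zero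
      embed (inj₂ (inj₁ (suc j))) = suc (E.embed (inj₂ (inj₁ j)))
      embed (inj₁ i)              = suc (E.embed (inj₁ i))
      embed (inj₂ (inj₂ k))       = suc (E.embed (inj₂ (inj₂ k)))
      view : Fin (suc n) → Layers a (suc b) c
      view zero    = inj₂ (inj₁ zero)
      view (suc v) = map₂ (map₁ suc) (E.view v)
      view-embed : ∀ x → view (embed x) ≡ x
      view-embed (inj₂ (inj₁ zero))    = refl
      view-embed (inj₂ (inj₁ (suc j))) = cong (map₂ (map₁ suc)) (E.view-embed (inj₂ (inj₁ j)))
      view-embed (inj₁ i)              = cong (map₂ (map₁ suc)) (E.view-embed (inj₁ i))
      view-embed (inj₂ (inj₂ k))       = cong (map₂ (map₁ suc)) (E.view-embed (inj₂ (inj₂ k)))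
      embed-view : ∀ v → embed (view v) ≡ v
      embed-view zero = refl
      embed-view (suc v) with E.view v | E.embed-view v
      ... | inj₁ i        | eq = cong suc eq
      ... | inj₂ (inj₁ j) | eq = cong suc eq
      ... | inj₂ (inj₂ k) | eq = cong suc eq
      layer-embed : ∀ x → l (embed x) ≡ layerOf x
      layer-embed (inj₂ (inj₁ zero))    = l₀
      layer-embed (inj₂ (inj₁ (suc j))) = E.layer-embed (inj₂ (inj₁ j))
      layer-embed (inj₁ i)              = E.layer-embed (inj₁ i)
      layer-embed (inj₂ (inj₂ k))       = E.layer-embed (inj₂ (inj₂ k))
      assoc : ∀ x p q r → x + (p + q + r) ≡ p + (x + q) + r
      assoc = solve-∀

    push₃ : l zero ≡ suc (suc zero) → LayerEnumeration l a b (suc c)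
    push₃ l₀ = record
      { embed = embed ; view = view ; view-embed = view-embed ; embed-view = embed-view
      ; layer-embed = layer-embed
      ; Σℤ-layers = λ f → trans (Σℤ-suc f) (assoc (f zero) (Σ₁ f) (Σ₂ f) (Σ₃ f)) }
      where
      embed : Layers a b (suc c) → Fin (suc n)
      embed (inj₂ (inj₂ zero))    = zero
      embed (inj₂ (inj₂ (suc k))) = suc (E.embed (inj₂ (inj₂ k)))
      embed (inj₁ i)              = suc (E.embed (inj₁ i))
      embed (inj₂ (inj₁ j))       = suc (E.embed (inj₂ (inj₁ j)))
      view : Fin (suc n) → Layers a b (suc c)
      view zero    = inj₂ (inj₂ zero)
      view (suc v) = map₂ (map₂ suc) (E.view v)
      view-embed : ∀ x → view (embed x) ≡ x
      view-embed (inj₂ (inj₂ zero))    = refl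
      view-embed (inj₂ (inj₂ (suc k))) = cong (map₂ (map₂ suc)) (E.view-embed (inj₂ (inj₂ k)))
      view-embed (inj₁ i)              = cong (map₂ (map₂ suc)) (E.view-embed (inj₁ i))
      view-embed (inj₂ (inj₁ j))       = cong (map₂ (map₂ suc)) (E.view-embed (inj₂ (inj₁ j)))
      embed-view : ∀ v → embed (view v) ≡ v
      embed-view zero = refl
      embed-view (suc v) with E.view v | E.embed-view v
      ... | inj₁ i        | eq = cong suc eq
      ... | inj₂ (inj₁ j) | eq = cong suc eq
      ... | inj₂ (inj₂ k) | eq = cong suc eq
      layer-embed : ∀ x → l (embed x) ≡ layerOf x
      layer-embed (inj₂ (inj₂ zero))    = l₀
      layer-embed (inj₂ (inj₂ (suc k))) = E.layer-embed (inj₂ (inj₂ k))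
      layer-embed (inj₁ i)              = E.layer-embed (inj₁ i)
      layer-embed (inj₂ (inj₁ j))       = E.layer-embed (inj₂ (inj₁ j))
      assoc : ∀ x p q r → x + (p + q + r) ≡ p + q + (x + r)
      assoc = solve-∀

  layerEnumeration : ∀ {n} (l : Fin n → Fin 3) →
    LayerEnumeration l (layerCount l zero) (layerCount l (suc zero)) (layerCount l (suc (suc zero)))
  layerEnumeration {zero} l = record
    { embed = λ { (inj₁ ()) ; (inj₂ (inj₁ ())) ; (inj₂ (inj₂ ())) }
    ; view = λ () ; view-embed = λ { (inj₁ ()) ; (inj₂ (inj₁ ())) ; (inj₂ (inj₂ ())) }
    ; embed-view = λ () ; layer-embed = λ { (inj₁ ()) ; (inj₂ (inj₁ ())) ; (inj₂ (inj₂ ())) }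
    ; Σℤ-layers = λ _ → refl }
  layerEnumeration {suc n} l with l zero in l₀ | layerEnumeration (l ∘ suc)
  ... | zero           | E = push₁ E l₀
  ... | suc zero       | E = push₂ E l₀
  ... | suc (suc zero) | E = push₃ E l₀

  layerEnumerationOfSizes : ∀ {n} (l : Fin n → Fin 3) {a b c} →
    layerSize l zero ≡ a → layerSize l (suc zero) ≡ b → layerSize l (suc (suc zero)) ≡ c →
    LayerEnumeration l a b c
  layerEnumerationOfSizes l refl refl refl
    rewrite layerSize≡layerCount l zero
          | layerSize≡layerCount l (suc zero)
          | layerSize≡layerCount l (suc (suc zero)) = layerEnumeration l

  -- The transposed Laplacian

  module _ {n} (G : DiGraph n) where
    open DiGraph G

    Lᵀ : (Fin n → ℤ) → Fin n → ℤ
    Lᵀ x j = Σℤ (λ i → Laplacian G i j * x i)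

    Lᵀ-loopless : (∀ j → arr j j ≡ 0) →
                  ∀ x j → Lᵀ x j ≡ + outdeg G j * x j - Σℤ (λ i → + arr i j * x i)
    Lᵀ-loopless noLoops x j = begin
      Σℤ (λ i → Laplacian G i j * x i)        ≡⟨ Σℤ-cong entry ⟩
      Σℤ (λ i → diagonal i - inflow i)        ≡⟨ Σℤ-- diagonal inflow ⟩
      Σℤ diagonal - Σℤ inflow                 ≡⟨ cong (_- Σℤ inflow) (Σℤ-single j diagonal off-diagonal) ⟩
      diagonal j - Σℤ inflow                  ≡⟨ cong (_- Σℤ inflow) diagonal-j ⟩
      + outdeg G j * x j - Σℤ inflow          ∎
      where
      open ≡.≡-Reasoning
      inflow diagonal : Fin n → ℤ
      inflow i = + arr i j * x i
      diagonal i = if does (i ≟ j) then + outdeg G j * x j else + 0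
      entry : ∀ i → Laplacian G i j * x i ≡ diagonal i - inflow i
      entry i with i ≟ j
      ... | yes refl rewrite noLoops i = sym (ℤ.+-identityʳ _)
      ... | no _ = trans (sym (ℤ.neg-distribˡ-* (+ arr i j) (x i))) (sym (ℤ.+-identityˡ _))
      off-diagonal : ∀ i → i ≢ j → diagonal i ≡ + 0
      off-diagonal i i≢j with i ≟ j
      ... | yes i≡j = ⊥-elim (i≢j i≡j)
      ... | no _    = refl
      diagonal-j : diagonal j ≡ + outdeg G j * x j
      diagonal-j with j ≟ j
      ... | yes _  = refl
      ... | no j≢j = ⊥-elim (j≢j refl)

  arrowCount : ∀ {t} → Fin t → Fin t → ℕ
  arrowCount k k′ = if NextLayer k k′ then 1 else 0

  NextLayer-irrefl : ∀ {t} (k : Fin t) → NextLayer k k ≡ false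
  NextLayer-irrefl k = dec-false (suc (toℕ k) ℕ.≟ toℕ k) ℕ.1+n≢n

  module ThreeLayers {n} (G : DiGraph n) (l : Fin n → Fin 3)
    (arrows : ∀ u v → DiGraph.arr G u v ≡ arrowCount (l u) (l v))
    {a b c} (E : LayerEnumeration l a b c) where
    open DiGraph G
    open LayerEnumeration E public

    S₁ S₂ S₃ : (Fin n → ℤ) → ℤ
    S₁ x = Σℤ (x ∘ e₁)
    S₂ x = Σℤ (x ∘ e₂)
    S₃ x = Σℤ (x ∘ e₃)

    Σℤ-by-layer : ∀ (w : Fin 3 → ℤ) f →
      Σℤ (λ u → w (l u) * f u) ≡ w zero * S₁ f + w (suc zero) * S₂ f + w (suc (suc zero)) * S₃ f
    Σℤ-by-layer w f = trans (Σℤ-layers _)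
      (cong₂ _+_ (cong₂ _+_ (block zero inj₁ λ _ → refl) (block (suc zero) (inj₂ ∘ inj₁) λ _ → refl))
                 (block (suc (suc zero)) (inj₂ ∘ inj₂) λ _ → refl))
      where
      block : ∀ {m} k (ι : Fin m → Layers a b c) → (∀ i → layerOf (ι i) ≡ k) →
              Σℤ (λ i → w (l (embed (ι i))) * f (embed (ι i))) ≡ w k * Σℤ (f ∘ embed ∘ ι)
      block k ι ι-layer = trans
        (Σℤ-cong (λ i → cong (λ k′ → w k′ * f (embed (ι i))) (trans (layer-embed (ι i)) (ι-layer i))))
        (Σℤ-* (w k) (f ∘ embed ∘ ι))

    no-loops : ∀ v → arr v v ≡ 0
    no-loops v = trans (arrows v v) (cong (if_then 1 else 0) (NextLayer-irrefl (l v)))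

    private
      out : Fin 3 → Fin 3 → ℤ
      out k k′ = + arrowCount k k′

    Lᵀ-by-layer : ∀ x v → Lᵀ G x v ≡
      (+ a * out (l v) zero + + b * out (l v) (suc zero) + + c * out (l v) (suc (suc zero))) * x v
      - (out zero (l v) * S₁ x + out (suc zero) (l v) * S₂ x + out (suc (suc zero)) (l v) * S₃ x)
    Lᵀ-by-layer x v = trans (Lᵀ-loopless G no-loops x v) (cong₂ (λ d s → d * x v - s) outdegree inflow)
      where
      w = out (l v)
      outdegree : + outdeg G v ≡ + a * w zero + + b * w (suc zero) + + c * w (suc (suc zero))
      outdegree = begin
        + outdeg G v
          ≡⟨ Σℕ⇒Σℤ (arr v) ⟩
        Σℤ (λ u → + arr v u)
          ≡⟨ Σℤ-cong (λ u → trans (cong +_ (arrows v u)) (sym (ℤ.*-identityʳ _))) ⟩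
        Σℤ (λ u → w (l u) * + 1)
          ≡⟨ Σℤ-by-layer w (λ _ → + 1) ⟩
        w zero * Σℤ {a} one + w (suc zero) * Σℤ {b} one + w (suc (suc zero)) * Σℤ {c} one
          ≡⟨ cong₂ _+_ (cong₂ _+_ (cong (w zero *_) (Σℤ-const {a} (+ 1)))
                                  (cong (w (suc zero) *_) (Σℤ-const {b} (+ 1))))
                       (cong (w (suc (suc zero)) *_) (Σℤ-const {c} (+ 1))) ⟩
        w zero * (+ a * + 1) + w (suc zero) * (+ b * + 1) + w (suc (suc zero)) * (+ c * + 1)
          ≡⟨ rearrange (w zero) (w (suc zero)) (w (suc (suc zero))) (+ a) (+ b) (+ c) ⟩
        + a * w zero + + b * w (suc zero) + + c * w (suc (suc zero))  ∎
        where
        open ≡.≡-Reasoning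
        one : ∀ {m} → Fin m → ℤ
        one _ = + 1
        rearrange : ∀ p q r a b c → p * (a * + 1) + q * (b * + 1) + r * (c * + 1) ≡ a * p + b * q + c * r
        rearrange = solve-∀
      inflow : Σℤ (λ i → + arr i v * x i) ≡
               out zero (l v) * S₁ x + out (suc zero) (l v) * S₂ x + out (suc (suc zero)) (l v) * S₃ x
      inflow = trans (Σℤ-cong (λ i → cong (λ m → + m * x i) (arrows i v))) (Σℤ-by-layer (λ k → out k (l v)) x)

    Lᵀ-e₁ : ∀ x i → Lᵀ G x (e₁ i) ≡ + b * x (e₁ i)
    Lᵀ-e₁ x i rewrite Lᵀ-by-layer x (e₁ i) | layer-embed (inj₁ i) =
      simplify (+ a) (+ b) (+ c) (x (e₁ i)) (S₁ x) (S₂ x) (S₃ x)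
      where
      simplify : ∀ A B C y s₁ s₂ s₃ → (A * + 0 + B * + 1 + C * + 0) * y - (+ 0 * s₁ + + 0 * s₂ + + 0 * s₃) ≡ B * y
      simplify = solve-∀

    Lᵀ-e₂ : ∀ x j → Lᵀ G x (e₂ j) ≡ + c * x (e₂ j) - S₁ x
    Lᵀ-e₂ x j rewrite Lᵀ-by-layer x (e₂ j) | layer-embed (inj₂ (inj₁ j)) =
      simplify (+ a) (+ b) (+ c) (x (e₂ j)) (S₁ x) (S₂ x) (S₃ x)
      where
      simplify : ∀ A B C y s₁ s₂ s₃ → (A * + 0 + B * + 0 + C * + 1) * y - (+ 1 * s₁ + + 0 * s₂ + + 0 * s₃) ≡ C * y - s₁
      simplify = solve-∀

    Lᵀ-e₃ : ∀ x k → Lᵀ G x (e₃ k) ≡ - S₂ x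
    Lᵀ-e₃ x k rewrite Lᵀ-by-layer x (e₃ k) | layer-embed (inj₂ (inj₂ k)) =
      simplify (+ a) (+ b) (+ c) (x (e₃ k)) (S₁ x) (S₂ x) (S₃ x)
      where
      simplify : ∀ A B C y s₁ s₂ s₃ → (A * + 0 + B * + 0 + C * + 0) * y - (+ 0 * s₁ + + 1 * s₂ + + 0 * s₃) ≡ - s₂
      simplify = solve-∀

  -- Picard and Jacobian groups from explicit coordinates

  module _ {n} (G : DiGraph n) where

    Lᵀ-+ : ∀ x y j → Lᵀ G (λ i → x i + y i) j ≡ Lᵀ G x j + Lᵀ G y j
    Lᵀ-+ x y j = trans (Σℤ-cong (λ i → ℤ.*-distribˡ-+ (Laplacian G i j) (x i) (y i))) (Σℤ-+ {n} _ _)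

    Lᵀ-neg : ∀ x j → Lᵀ G (λ i → - x i) j ≡ - Lᵀ G x j
    Lᵀ-neg x j = trans (Σℤ-cong (λ i → sym (ℤ.neg-distribʳ-* (Laplacian G i j) (x i)))) (Σℤ-neg {n} _)

    Lᵀ-zero : ∀ j → Lᵀ G (λ _ → + 0) j ≡ + 0
    Lᵀ-zero j = trans (Σℤ-cong (λ i → ℤ.*-zeroʳ (Laplacian G i j))) (Σℤ-zero {n})

    PicRel-reflexive : ∀ {u v} → (∀ j → u j ≡ v j) → PicRel G u v
    PicRel-reflexive {u} {v} u≡v = (λ _ → + 0) , λ j →
      trans (cong (_-_ (u j)) (sym (u≡v j))) (trans (ℤ.+-inverseʳ (u j)) (sym (Lᵀ-zero j)))

    PicRel-sym : ∀ {u v} → PicRel G u v → PicRel G v u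
    PicRel-sym {u} {v} (x , u-v≡Lx) = (λ i → - x i) , λ j →
      trans (sym (neg-minus (u j) (v j))) (trans (cong -_ (u-v≡Lx j)) (sym (Lᵀ-neg x j)))
      where
      neg-minus : ∀ a b → - (a - b) ≡ b - a
      neg-minus = solve-∀

    PicRel-trans : ∀ {u v w} → PicRel G u v → PicRel G v w → PicRel G u w
    PicRel-trans {u} {v} {w} (x , u-v≡Lx) (y , v-w≡Ly) = (λ i → x i + y i) , λ j →
      trans (sym (telescope (u j) (v j) (w j))) (trans (cong₂ _+_ (u-v≡Lx j) (v-w≡Ly j)) (sym (Lᵀ-+ x y j)))
      where
      telescope : ∀ a b c → (a - b) + (b - c) ≡ a - c
      telescope = solve-∀

    PicRel-+ : ∀ {u v u′ v′} → PicRel G u v → PicRel G u′ v′ → PicRel G (λ i → u i + u′ i) (λ i → v i + v′ i)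
    PicRel-+ {u} {v} {u′} {v′} (x , u-v≡Lx) (y , u′-v′≡Ly) = (λ i → x i + y i) , λ j →
      trans (sym (interchange (u j) (v j) (u′ j) (v′ j)))
        (trans (cong₂ _+_ (u-v≡Lx j) (u′-v′≡Ly j)) (sym (Lᵀ-+ x y j)))
      where
      interchange : ∀ a b c d → (a - b) + (c - d) ≡ (a + c) - (b + d)
      interchange = solve-∀

    PicRel-neg : ∀ {u v} → PicRel G u v → PicRel G (λ i → - u i) (λ i → - v i)
    PicRel-neg {u} {v} (x , u-v≡Lx) = (λ i → - x i) , λ j →
      trans (sym (neg-minus (u j) (v j))) (trans (cong -_ (u-v≡Lx j)) (sym (Lᵀ-neg x j)))
      where
      neg-minus : ∀ a b → - (a - b) ≡ - a - - b
      neg-minus = solve-∀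

    PicRel-difference : ∀ {u v w} → (∀ j → u j - v j ≡ w j) → PicRel G w (λ _ → + 0) → PicRel G u v
    PicRel-difference {w = w} u-v≡w (x , w≡Lx) = x , λ j → trans (u-v≡w j) (trans (sym (ℤ.+-identityʳ (w j))) (w≡Lx j))

    Picᶜ : CongruentGroup
    Picᶜ = record
      { rawGroup    = Pic G
      ; isCongruent = record
        { isEquivalence = record
          { refl  = λ {x} → PicRel-reflexive {x} (λ _ → refl)
          ; sym   = λ {x} {y} → PicRel-sym {x} {y}
          ; trans = λ {x} {y} {z} → PicRel-trans {x} {y} {z} }
        ; ∙-cong  = λ {x} {y} {u} {v} → PicRel-+ {x} {y} {u} {v}
        ; ⁻¹-cong = λ {x} {y} → PicRel-neg {x} {y} } }

    Jacᶜ : CongruentGroup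
    Jacᶜ = record
      { rawGroup    = Jac G
      ; isCongruent = record
        { isEquivalence = record
          { refl  = λ {x} → PicRel-reflexive {proj₁ x} (λ _ → refl)
          ; sym   = λ {x} {y} → PicRel-sym {proj₁ x} {proj₁ y}
          ; trans = λ {x} {y} {z} → PicRel-trans {proj₁ x} {proj₁ y} {proj₁ z} }
        ; ∙-cong  = λ {x} {y} {u} {v} → PicRel-+ {proj₁ x} {proj₁ y} {proj₁ u} {proj₁ v}
        ; ⁻¹-cong = λ {x} {y} → PicRel-neg {proj₁ x} {proj₁ y} } }

  record Decomposition {n} (G : DiGraph n) (c : ℕ) (T : CongruentGroup) : Set where
    private
      module T = CongruentGroup T
    field
      free            : (Fin n → ℤ) → Fin c → ℤ
      finite          : (Fin n → ℤ) → T.Carrier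
      assemble        : (Fin c → ℤ) → T.Carrier → Fin n → ℤ
      free-cong       : ∀ {u v} → PicRel G u v → ∀ i → free u i ≡ free v i
      finite-cong     : ∀ {u v} → PicRel G u v → finite u T.≈ finite v
      assemble-cong   : ∀ {f f′ t t′} → (∀ i → f i ≡ f′ i) → t T.≈ t′ → PicRel G (assemble f t) (assemble f′ t′)
      free-+          : ∀ u v i → free (λ j → u j + v j) i ≡ free u i + free v i
      free-zero       : ∀ i → free (λ _ → + 0) i ≡ + 0
      free-neg        : ∀ u i → free (λ j → - u j) i ≡ - free u i
      free-scale      : ∀ k u i → free (scale k u) i ≡ + k * free u i
      finite-+        : ∀ u v → finite (λ j → u j + v j) T.≈ (finite u T.∙ finite v)
      finite-zero     : finite (λ _ → + 0) T.≈ T.ε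
      finite-neg      : ∀ u → finite (λ j → - u j) T.≈ (finite u T.⁻¹)
      free-assemble   : ∀ f t i → free (assemble f t) i ≡ f i
      finite-assemble : ∀ f t → finite (assemble f t) T.≈ t
      assemble-split  : ∀ u → PicRel G (assemble (free u) (finite u)) u
      exponent        : ℕ
      exponent-pos    : 1 ℕ.≤ exponent
      finite-exponent : ∀ u → finite (scale exponent u) T.≈ T.ε

  module _ {n} {G : DiGraph n} {c T} (D : Decomposition G c T) where
    open Decomposition D
    private
      module T = CongruentGroup T
      module P = CongruentGroup (Picᶜ G)
      0ᶠ : ∀ {m} → Fin m → ℤ
      0ᶠ _ = + 0

    Pic≃ℤ^c⊗T : Picᶜ G ≃ ℤᶜ ^ᶜ c ⊗ᶜ T
    Pic≃ℤ^c⊗T = begin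
      Picᶜ G             ≈⟨ split ⟩
      Vecᶜ ℤᶜ c ⊗ᶜ T     ≈⟨ ⊗-congˡ (Vecᶜ ℤᶜ c) (ℤᶜ ^ᶜ c) T (Vec≃^ ℤᶜ c) ⟩
      ℤᶜ ^ᶜ c ⊗ᶜ T       ∎
      where
      open ≃-Reasoning
      split : Picᶜ G ≃ Vecᶜ ℤᶜ c ⊗ᶜ T
      split = inverses⇒≃ (Picᶜ G) (Vecᶜ ℤᶜ c ⊗ᶜ T) record
        { to        = λ u → free u , finite u
        ; from      = λ (f , t) → assemble f t
        ; to-cong   = λ u~v → free-cong u~v , finite-cong u~v
        ; from-cong = λ (f≡ , t≈) → assemble-cong f≡ t≈
        ; to-∙      = λ u v → free-+ u v , finite-+ u v
        ; to-ε      = free-zero , finite-zero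
        ; to-⁻¹     = λ u → free-neg u , finite-neg u
        ; from-to   = assemble-split
        ; to-from   = λ (f , t) → free-assemble f t , finite-assemble f t }

    -- A torsion class has no free part, because the free coordinates are ℤ-valued and linear.
    free-torsion : ∀ u → IsTorsion G u → ∀ i → free u i ≡ + 0
    free-torsion u (suc k , _ , ku~0) i = ℤ.*-cancelˡ-≡ (+ suc k) (free u i) (+ 0) (begin
      + suc k * free u i      ≡⟨ free-scale (suc k) u i ⟨
      free (scale (suc k) u) i ≡⟨ free-cong ku~0 i ⟩
      free 0ᶠ i               ≡⟨ free-zero i ⟩
      + 0                     ≡⟨ ℤ.*-zeroʳ (+ suc k) ⟨
      + suc k * + 0           ∎)
      where open ≡.≡-Reasoning

    -- Conversely, T has finite exponent, so everything assembled with zero free part is torsion.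
    assemble-torsion : ∀ t → IsTorsion G (assemble 0ᶠ t)
    assemble-torsion t = exponent , exponent-pos , (begin
      scale exponent u                                           ≈⟨ assemble-split (scale exponent u) ⟨
      assemble (free (scale exponent u)) (finite (scale exponent u)) ≈⟨ assemble-cong no-free (finite-exponent u) ⟩
      assemble 0ᶠ T.ε                                            ≈⟨ assemble-cong free-zero finite-zero ⟨
      assemble (free 0ᶠ) (finite 0ᶠ)                             ≈⟨ assemble-split 0ᶠ ⟩
      0ᶠ                                                         ∎)
      where
      open import Relation.Binary.Reasoning.Setoid P.setoid
      u = assemble 0ᶠ t
      no-free : ∀ i → free (scale exponent u) i ≡ + 0
      no-free i = trans (free-scale exponent u i)
        (trans (cong (+ exponent *_) (free-assemble 0ᶠ t i)) (ℤ.*-zeroʳ (+ exponent)))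

    Jac≃T : Jacᶜ G ≃ T
    Jac≃T = inverses⇒≃ (Jacᶜ G) T record
      { to        = λ (u , _) → finite u
      ; from      = λ t → assemble 0ᶠ t , assemble-torsion t
      ; to-cong   = finite-cong
      ; from-cong = assemble-cong (λ _ → refl)
      ; to-∙      = λ (u , _) (v , _) → finite-+ u v
      ; to-ε      = finite-zero
      ; to-⁻¹     = λ (u , _) → finite-neg u
      ; from-to   = λ (u , u-torsion) →
          PicRel-trans G {assemble 0ᶠ (finite u)} {assemble (free u) (finite u)} {u}
            (assemble-cong (λ i → sym (free-torsion u u-torsion i)) T.refl) (assemble-split u)
      ; to-from   = finite-assemble 0ᶠ }

    Pic≃ℤ^c⊗Jac : Picᶜ G ≃ ℤᶜ ^ᶜ c ⊗ᶜ Jacᶜ G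
    Pic≃ℤ^c⊗Jac = ≃-trans (Picᶜ G) (ℤᶜ ^ᶜ c ⊗ᶜ T) (ℤᶜ ^ᶜ c ⊗ᶜ Jacᶜ G) Pic≃ℤ^c⊗T
      (⊗-congʳ (ℤᶜ ^ᶜ c) T (Jacᶜ G) (≃-sym (Jacᶜ G) T Jac≃T))

  -- Linear functionals

  module _ {n : ℕ} where

    record IsLinear (ψ : (Fin n → ℤ) → ℤ) : Set where
      field
        linear         : ∀ α β u v → ψ (λ j → α * u j + β * v j) ≡ α * ψ u + β * ψ v
        pointwise-cong : ∀ {u v} → (∀ j → u j ≡ v j) → ψ u ≡ ψ v

      +-homo : ∀ u v → ψ (λ j → u j + v j) ≡ ψ u + ψ v
      +-homo u v = begin
        ψ (λ j → u j + v j)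
          ≡⟨ pointwise-cong (λ j → cong₂ _+_ (ℤ.*-identityˡ (u j)) (ℤ.*-identityˡ (v j))) ⟨
        ψ (λ j → + 1 * u j + + 1 * v j)       ≡⟨ linear (+ 1) (+ 1) u v ⟩
        + 1 * ψ u + + 1 * ψ v                 ≡⟨ cong₂ _+_ (ℤ.*-identityˡ (ψ u)) (ℤ.*-identityˡ (ψ v)) ⟩
        ψ u + ψ v                             ∎
        where open ≡.≡-Reasoning

      scale-homo : ∀ k u → ψ (scale k u) ≡ + k * ψ u
      scale-homo k u = begin
        ψ (scale k u)                         ≡⟨ pointwise-cong (λ j → drop-zero (+ k * u j) (u j)) ⟨
        ψ (λ j → + k * u j + + 0 * u j)       ≡⟨ linear (+ k) (+ 0) u u ⟩
        + k * ψ u + + 0 * ψ u                 ≡⟨ drop-zero (+ k * ψ u) (ψ u) ⟩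
        + k * ψ u                             ∎
        where
        open ≡.≡-Reasoning
        drop-zero : ∀ x y → x + + 0 * y ≡ x
        drop-zero = solve-∀

      zero-homo : ψ (λ _ → + 0) ≡ + 0
      zero-homo = trans (pointwise-cong (λ _ → sym (ℤ.*-zeroˡ (+ 0))))
        (trans (scale-homo 0 (λ _ → + 0)) (ℤ.*-zeroˡ (ψ (λ _ → + 0))))

      neg-homo : ∀ u → ψ (λ j → - u j) ≡ - ψ u
      neg-homo u = trans (pointwise-cong (λ j → minus-one (u j))) (trans (linear (ℤ.-1ℤ) (+ 0) u u) (minus-one′ (ψ u)))
        where
        minus-one : ∀ x → - x ≡ ℤ.-1ℤ * x + + 0 * x
        minus-one = solve-∀
        minus-one′ : ∀ x → ℤ.-1ℤ * x + + 0 * x ≡ - x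
        minus-one′ = solve-∀

      minus-homo : ∀ u v → ψ (λ j → u j - v j) ≡ ψ u - ψ v
      minus-homo u v = trans (+-homo u (λ j → - v j)) (≡.cong (_+_ (ψ u)) (neg-homo v))

    coordinate-linear : ∀ v → IsLinear (λ u → u v)
    coordinate-linear v = record { linear = λ _ _ _ _ → refl ; pointwise-cong = λ u≡v → u≡v v }

    sum-linear : ∀ {m} (e : Fin m → Fin n) → IsLinear (λ u → Σℤ (u ∘ e))
    sum-linear e = record
      { linear = λ α β u v → trans (Σℤ-+ (λ i → α * u (e i)) (λ i → β * v (e i)))
                                   (cong₂ _+_ (Σℤ-* α (u ∘ e)) (Σℤ-* β (v ∘ e)))
      ; pointwise-cong = λ u≡v → Σℤ-cong (u≡v ∘ e) }

    module _ {ψ φ} (ψ-linear : IsLinear ψ) (φ-linear : IsLinear φ) where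
      private
        module ψ = IsLinear ψ-linear
        module φ = IsLinear φ-linear

      +-linear : IsLinear (λ u → ψ u + φ u)
      +-linear = record
        { linear = λ α β u v → trans (cong₂ _+_ (ψ.linear α β u v) (φ.linear α β u v))
                                     (distrib α β (ψ u) (ψ v) (φ u) (φ v))
        ; pointwise-cong = λ u≡v → cong₂ _+_ (ψ.pointwise-cong u≡v) (φ.pointwise-cong u≡v) }
        where
        distrib : ∀ α β a b c d → α * a + β * b + (α * c + β * d) ≡ α * (a + c) + β * (b + d)
        distrib = solve-∀

      minus-linear : IsLinear (λ u → ψ u - φ u)
      minus-linear = record
        { linear = λ α β u v → trans (cong₂ _-_ (ψ.linear α β u v) (φ.linear α β u v))
                                     (distrib α β (ψ u) (ψ v) (φ u) (φ v))
        ; pointwise-cong = λ u≡v → cong₂ _-_ (ψ.pointwise-cong u≡v) (φ.pointwise-cong u≡v) }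
        where
        distrib : ∀ α β a b c d → α * a + β * b - (α * c + β * d) ≡ α * (a - c) + β * (b - d)
        distrib = solve-∀

    scale-linear : ∀ {ψ} k → IsLinear ψ → IsLinear (λ u → k * ψ u)
    scale-linear {ψ} k ψ-linear = record
      { linear = λ α β u v → trans (cong (k *_) (ψ.linear α β u v)) (distrib k α β (ψ u) (ψ v))
      ; pointwise-cong = λ u≡v → cong (k *_) (ψ.pointwise-cong u≡v) }
      where
      module ψ = IsLinear ψ-linear
      distrib : ∀ k α β a b → k * (α * a + β * b) ≡ α * (k * a) + β * (k * b)
      distrib = solve-∀

  module _ {n} (G : DiGraph n) {ψ : (Fin n → ℤ) → ℤ} (ψ-linear : IsLinear ψ) where
    open IsLinear ψ-linear

    linear-invariant : (∀ x → ψ (Lᵀ G x) ≡ + 0) → ∀ {u v} → PicRel G u v → ψ u ≡ ψ v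
    linear-invariant ψLᵀ≡0 {u} {v} (x , u-v≡Lx) =
      ℤ.i-j≡0⇒i≡j (ψ u) (ψ v) (trans (sym (minus-homo u v)) (trans (pointwise-cong u-v≡Lx) (ψLᵀ≡0 x)))

    linear-invariant-mod : ∀ m (K : (Fin n → ℤ) → ℤ) → (∀ x → ψ (Lᵀ G x) ≡ K x * + m) →
                           ∀ {u v} → PicRel G u v → ψ u ≡ ψ v [mod m ]
    linear-invariant-mod m K ψLᵀ≡Km {u} {v} (x , u-v≡Lx) =
      mod (divides (K x) (trans (sym (minus-homo u v)) (trans (pointwise-cong u-v≡Lx) (ψLᵀ≡Km x))))

  -- The free part, and the case b = 1

  module FreePart {n} (G : DiGraph n) (l : Fin n → Fin 3)
    (arrows : ∀ u v → DiGraph.arr G u v ≡ arrowCount (l u) (l v))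
    {a b c′} (E : LayerEnumeration l a b (suc c′)) where
    open ThreeLayers G l arrows E public

    S₁-Lᵀ : ∀ x → S₁ (Lᵀ G x) ≡ + b * S₁ x
    S₁-Lᵀ x = trans (Σℤ-cong (Lᵀ-e₁ x)) (Σℤ-* (+ b) (x ∘ e₁))

    S₂-Lᵀ : ∀ x → S₂ (Lᵀ G x) ≡ + suc c′ * S₂ x - + b * S₁ x
    S₂-Lᵀ x = trans (Σℤ-cong (Lᵀ-e₂ x))
      (trans (Σℤ-- (λ j → + suc c′ * x (e₂ j)) (λ _ → S₁ x))
             (cong₂ _-_ (Σℤ-* (+ suc c′) (x ∘ e₂)) (Σℤ-const {b} (S₁ x))))

    PicRel-by-layer : ∀ u v x →
      (∀ i → u (e₁ i) - v (e₁ i) ≡ + b * x (e₁ i)) →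
      (∀ j → u (e₂ j) - v (e₂ j) ≡ + suc c′ * x (e₂ j) - S₁ x) →
      (∀ k → u (e₃ k) - v (e₃ k) ≡ - S₂ x) → PicRel G u v
    PicRel-by-layer u v x on₁ on₂ on₃ = x , by-layer (λ j → u j - v j ≡ Lᵀ G x j)
      (λ i → trans (on₁ i) (sym (Lᵀ-e₁ x i)))
      (λ j → trans (on₂ j) (sym (Lᵀ-e₂ x j)))
      (λ k → trans (on₃ k) (sym (Lᵀ-e₃ x k)))

    degree : (Fin n → ℤ) → ℤ
    degree u = S₁ u + S₂ u + + suc c′ * u (e₃ zero)

    free : (Fin n → ℤ) → Fin (suc c′) → ℤ
    free u zero    = degree u
    free u (suc k) = u (e₃ (suc k)) - u (e₃ zero)

    free-linear : ∀ i → IsLinear (λ u → free u i)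
    free-linear zero    = +-linear (+-linear (sum-linear e₁) (sum-linear e₂)) (scale-linear (+ suc c′) (coordinate-linear _))
    free-linear (suc k) = minus-linear (coordinate-linear _) (coordinate-linear _)

    free-Lᵀ : ∀ i x → free (Lᵀ G x) i ≡ + 0
    free-Lᵀ zero x rewrite S₁-Lᵀ x | S₂-Lᵀ x | Lᵀ-e₃ x zero = cancel (+ b) (+ suc c′) (S₁ x) (S₂ x)
      where
      cancel : ∀ B C s₁ s₂ → B * s₁ + (C * s₂ - B * s₁) + C * (- s₂) ≡ + 0
      cancel = solve-∀
    free-Lᵀ (suc k) x rewrite Lᵀ-e₃ x (suc k) | Lᵀ-e₃ x zero = ℤ.+-inverseʳ (- S₂ x)

    free-cong : ∀ {u v} → PicRel G u v → ∀ i → free u i ≡ free v i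
    free-cong u~v i = linear-invariant G (free-linear i) (free-Lᵀ i) u~v

    free-+ : ∀ u v i → free (λ j → u j + v j) i ≡ free u i + free v i
    free-+ u v i = IsLinear.+-homo (free-linear i) u v

    free-zero : ∀ i → free (λ _ → + 0) i ≡ + 0
    free-zero i = IsLinear.zero-homo (free-linear i)

    free-neg : ∀ u i → free (λ j → - u j) i ≡ - free u i
    free-neg u i = IsLinear.neg-homo (free-linear i) u

    free-scale : ∀ k u i → free (scale k u) i ≡ + k * free u i
    free-scale k u i = IsLinear.scale-homo (free-linear i) k u

    sink : (Fin (suc c′) → ℤ) → Fin (suc c′) → ℤ
    sink f zero    = + 0
    sink f (suc k) = f (suc k)

    sink-cong : ∀ {f f′} → (∀ i → f i ≡ f′ i) → ∀ k → sink f k ≡ sink f′ k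
    sink-cong f≡f′ zero    = refl
    sink-cong f≡f′ (suc k) = f≡f′ (suc k)

    free-layered-sink : ∀ x y f k → free (layered x y (sink f)) (suc k) ≡ f (suc k)
    free-layered-sink x y f k rewrite layered-e₃ x y (sink f) zero | layered-e₃ x y (sink f) (suc k) =
      ℤ.+-identityʳ (f (suc k))

  module MiddleLayerOfSizeOne {n} (G : DiGraph n) (l : Fin n → Fin 3)
    (arrows : ∀ u v → DiGraph.arr G u v ≡ arrowCount (l u) (l v))
    {a c′} (E : LayerEnumeration l a 1 (suc c′)) where
    open FreePart G l arrows E

    private
      0ᶠ : ∀ {m} → Fin m → ℤ
      0ᶠ _ = + 0

    assemble : (Fin (suc c′) → ℤ) → ⊤ → Fin n → ℤ
    assemble f _ = layered 0ᶠ (λ _ → f zero) (sink f)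

    free-assemble : ∀ f t i → free (assemble f t) i ≡ f i
    free-assemble f t zero
      rewrite layered-e₃ 0ᶠ (λ _ → f zero) (sink f) zero
            | Σℤ-cong (layered-e₁ 0ᶠ (λ _ → f zero) (sink f))
            | Σℤ-zero {a}
            | layered-e₂ 0ᶠ (λ _ → f zero) (sink f) zero = simplify (f zero) (+ suc c′)
      where
      simplify : ∀ f C → + 0 + (f + + 0) + C * + 0 ≡ f
      simplify = solve-∀
    free-assemble f t (suc k) = free-layered-sink 0ᶠ (λ _ → f zero) f k

    assemble-split : ∀ u → PicRel G (assemble (free u) tt) u
    assemble-split u = PicRel-by-layer (assemble (free u) tt) u x on₁ on₂ on₃
      where
      r₀ = u (e₃ zero)
      x = layered (λ i → - u (e₁ i)) (λ _ → r₀) 0ᶠ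
      S₁x : S₁ x ≡ - S₁ u
      S₁x = trans (Σℤ-cong (layered-e₁ _ _ _)) (Σℤ-neg (u ∘ e₁))
      S₂x : S₂ x ≡ r₀
      S₂x = trans (Σℤ-cong (layered-e₂ _ _ _)) (ℤ.+-identityʳ r₀)
      on₁ : ∀ i → assemble (free u) tt (e₁ i) - u (e₁ i) ≡ + 1 * x (e₁ i)
      on₁ i rewrite layered-e₁ 0ᶠ (λ _ → free u zero) (sink (free u)) i
                  | layered-e₁ (λ i → - u (e₁ i)) (λ _ → r₀) 0ᶠ i = eq (u (e₁ i))
        where
        eq : ∀ p → + 0 - p ≡ + 1 * (- p)
        eq = solve-∀
      on₂ : ∀ j → assemble (free u) tt (e₂ j) - u (e₂ j) ≡ + suc c′ * x (e₂ j) - S₁ x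
      on₂ zero rewrite layered-e₂ 0ᶠ (λ _ → free u zero) (sink (free u)) zero
                     | layered-e₂ (λ i → - u (e₁ i)) (λ _ → r₀) 0ᶠ zero | S₁x =
        eq (S₁ u) (u (e₂ zero)) (+ suc c′) r₀
        where
        eq : ∀ s q C r → (s + (q + + 0) + C * r) - q ≡ C * r - (- s)
        eq = solve-∀
      on₃ : ∀ k → assemble (free u) tt (e₃ k) - u (e₃ k) ≡ - S₂ x
      on₃ zero rewrite layered-e₃ 0ᶠ (λ _ → free u zero) (sink (free u)) zero | S₂x = ℤ.+-identityˡ (- r₀)
      on₃ (suc k) rewrite layered-e₃ 0ᶠ (λ _ → free u zero) (sink (free u)) (suc k) | S₂x = eq (u (e₃ (suc k))) r₀
        where
        eq : ∀ y r → (y - r) - y ≡ - r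
        eq = solve-∀

    decomposition : Decomposition G (suc c′) trivialᶜ
    decomposition = record
      { free = free ; finite = λ _ → tt ; assemble = assemble
      ; free-cong = free-cong ; finite-cong = λ _ → tt
      ; assemble-cong = λ f≡ _ → PicRel-reflexive G (layered-cong (λ _ → refl) (λ _ → f≡ zero) (sink-cong f≡))
      ; free-+ = free-+ ; free-zero = free-zero ; free-neg = free-neg ; free-scale = free-scale
      ; finite-+ = λ _ _ → tt ; finite-zero = tt ; finite-neg = λ _ → tt
      ; free-assemble = free-assemble ; finite-assemble = λ _ _ → tt
      ; assemble-split = assemble-split
      ; exponent = 1 ; exponent-pos = ℕ.s≤s ℕ.z≤n ; finite-exponent = λ _ → tt }

  -- The case b ≥ 2

  module MiddleLayerOfSizeAtLeastTwo {n} (G : DiGraph n) (l : Fin n → Fin 3)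
    (arrows : ∀ u v → DiGraph.arr G u v ≡ arrowCount (l u) (l v))
    {a′ b′ c′} (E : LayerEnumeration l (suc a′) (suc (suc b′)) (suc c′)) where
    open FreePart G l arrows E

    b c : ℕ
    b = suc (suc b′)
    c = suc c′

    ℤ_b ℤ_c ℤ_g ℤ_l ℤ_bc : CongruentGroup
    ℤ_b  = ℤmodᶜ b
    ℤ_c  = ℤmodᶜ c
    ℤ_g  = ℤmodᶜ (gcd b c)
    ℤ_l  = ℤmodᶜ (lcm b c)
    ℤ_bc = ℤmodᶜ (b ℕ.* c)

    T : CongruentGroup
    T = Vecᶜ ℤ_b a′ ⊗ᶜ (Vecᶜ ℤ_c b′ ⊗ᶜ ℤ_bc)

    private
      module T = CongruentGroup T
      0ᶠ : ∀ {m} → Fin m → ℤ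
      0ᶠ _ = + 0
      q₁ : Fin n
      q₁ = e₂ (suc zero)
      bc≡b*c : + (b ℕ.* c) ≡ + b * + c
      bc≡b*c = ℤ.pos-* b c

    source : Fin a′ → (Fin n → ℤ) → ℤ
    source i u = u (e₁ (suc i))

    middle : Fin b′ → (Fin n → ℤ) → ℤ
    middle j u = u (e₂ (suc (suc j))) - u q₁

    mixed : (Fin n → ℤ) → ℤ
    mixed u = S₁ u + + b * u q₁

    source-linear : ∀ i → IsLinear (source i)
    source-linear i = coordinate-linear _
    middle-linear : ∀ j → IsLinear (middle j)
    middle-linear j = minus-linear (coordinate-linear _) (coordinate-linear _)
    mixed-linear : IsLinear mixed
    mixed-linear = +-linear (sum-linear e₁) (scale-linear (+ b) (coordinate-linear _))

    source-Lᵀ : ∀ i x → source i (Lᵀ G x) ≡ x (e₁ (suc i)) * + b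
    source-Lᵀ i x = trans (Lᵀ-e₁ x (suc i)) (ℤ.*-comm (+ b) _)

    middle-Lᵀ : ∀ j x → middle j (Lᵀ G x) ≡ (x (e₂ (suc (suc j))) - x q₁) * + c
    middle-Lᵀ j x = trans (cong₂ _-_ (Lᵀ-e₂ x (suc (suc j))) (Lᵀ-e₂ x (suc zero)))
      (eq (+ c) (x (e₂ (suc (suc j)))) (x q₁) (S₁ x))
      where
      eq : ∀ C p q s → (C * p - s) - (C * q - s) ≡ (p - q) * C
      eq = solve-∀

    mixed-Lᵀ : ∀ x → mixed (Lᵀ G x) ≡ x q₁ * + (b ℕ.* c)
    mixed-Lᵀ x = trans (cong₂ (λ s q → s + + b * q) (S₁-Lᵀ x) (Lᵀ-e₂ x (suc zero)))
      (trans (eq (+ b) (+ c) (S₁ x) (x q₁)) (cong (x q₁ *_) (sym bc≡b*c)))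
      where
      eq : ∀ B C s q → B * s + B * (C * q - s) ≡ q * (B * C)
      eq = solve-∀

    finite : (Fin n → ℤ) → T.Carrier
    finite u = (λ i → source i u) , (λ j → middle j u) , mixed u

    finite-cong : ∀ {u v} → PicRel G u v → finite u T.≈ finite v
    finite-cong {u} {v} u~v =
      (λ i → ≡[mod]⇒≈ b (linear-invariant-mod G (source-linear i) b (λ x → x (e₁ (suc i)))
                                               (source-Lᵀ i) {u} {v} u~v)) ,
      (λ j → ≡[mod]⇒≈ c (linear-invariant-mod G (middle-linear j) c (λ x → x (e₂ (suc (suc j))) - x q₁)
                                               (middle-Lᵀ j) {u} {v} u~v)) ,
      ≡[mod]⇒≈ (b ℕ.* c) (linear-invariant-mod G mixed-linear (b ℕ.* c) (λ x → x q₁) mixed-Lᵀ {u} {v} u~v)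

    private
      ≡⇒≈ : ∀ {s t : T.Carrier} →
        (∀ i → proj₁ s i ≡ proj₁ t i) → (∀ j → proj₁ (proj₂ s) j ≡ proj₁ (proj₂ t) j) →
        proj₂ (proj₂ s) ≡ proj₂ (proj₂ t) → s T.≈ t
      ≡⇒≈ on-source on-middle on-mixed =
        (λ i → CongruentGroup.reflexive (ℤmodᶜ b) (on-source i)) ,
        (λ j → CongruentGroup.reflexive (ℤmodᶜ c) (on-middle j)) ,
        CongruentGroup.reflexive (ℤmodᶜ (b ℕ.* c)) on-mixed

    finite-+ : ∀ u v → finite (λ j → u j + v j) T.≈ (finite u T.∙ finite v)
    finite-+ u v = ≡⇒≈ (λ i → IsLinear.+-homo (source-linear i) u v) (λ j → IsLinear.+-homo (middle-linear j) u v)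
                       (IsLinear.+-homo mixed-linear u v)

    finite-zero : finite 0ᶠ T.≈ T.ε
    finite-zero = ≡⇒≈ (λ i → IsLinear.zero-homo (source-linear i)) (λ j → IsLinear.zero-homo (middle-linear j))
                      (IsLinear.zero-homo mixed-linear)

    finite-neg : ∀ u → finite (λ j → - u j) T.≈ (finite u T.⁻¹)
    finite-neg u = ≡⇒≈ (λ i → IsLinear.neg-homo (source-linear i) u) (λ j → IsLinear.neg-homo (middle-linear j) u)
                       (IsLinear.neg-homo mixed-linear u)

    finite-exponent : ∀ u → finite (scale (b ℕ.* c) u) T.≈ T.ε
    finite-exponent u =
      (λ i → ≡[mod]⇒≈ b (multiple (+ c * source i u) (trans (IsLinear.scale-homo (source-linear i) (b ℕ.* c) u)
                                                             (comm₁ (source i u))))) ,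
      (λ j → ≡[mod]⇒≈ c (multiple (+ b * middle j u) (trans (IsLinear.scale-homo (middle-linear j) (b ℕ.* c) u)
                                                             (comm₂ (middle j u))))) ,
      ≡[mod]⇒≈ (b ℕ.* c) (multiple (mixed u) (trans (IsLinear.scale-homo mixed-linear (b ℕ.* c) u)
                                                    (ℤ.*-comm (+ (b ℕ.* c)) (mixed u))))
      where
      multiple : ∀ {m x} k → x ≡ k * + m → x ≡ + 0 [mod m ]
      multiple {m} {x} k x≡km = mod (divides k (trans (ℤ.+-identityʳ x) x≡km))
      comm₁ : ∀ s → + (b ℕ.* c) * s ≡ + c * s * + b
      comm₁ s = trans (cong (_* s) bc≡b*c) (eq (+ b) (+ c) s)
        where
        eq : ∀ B C s → B * C * s ≡ C * s * B
        eq = solve-∀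
      comm₂ : ∀ s → + (b ℕ.* c) * s ≡ + b * s * + c
      comm₂ s = trans (cong (_* s) bc≡b*c) (eq (+ b) (+ c) s)
        where
        eq : ∀ B C s → B * C * s ≡ B * s * C
        eq = solve-∀

    -- The representative with given coordinates: it vanishes at q₁ and at the first sink vertex,
    -- and p₀, q₀ absorb the mixed and degree coordinates.
    sourceValues : T.Carrier → Fin (suc a′) → ℤ
    sourceValues (δ , φ , η) zero    = η - Σℤ δ
    sourceValues (δ , φ , η) (suc i) = δ i

    middleValues : (Fin c → ℤ) → T.Carrier → Fin b → ℤ
    middleValues f (δ , φ , η) zero          = f zero - η - Σℤ φ
    middleValues f (δ , φ , η) (suc zero)    = + 0
    middleValues f (δ , φ , η) (suc (suc j)) = φ j

    assemble : (Fin c → ℤ) → T.Carrier → Fin n → ℤ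
    assemble f t = layered (sourceValues t) (middleValues f t) (sink f)

    assemble-e₁ : ∀ f t i → assemble f t (e₁ i) ≡ sourceValues t i
    assemble-e₁ f t = layered-e₁ (sourceValues t) (middleValues f t) (sink f)
    assemble-e₂ : ∀ f t j → assemble f t (e₂ j) ≡ middleValues f t j
    assemble-e₂ f t = layered-e₂ (sourceValues t) (middleValues f t) (sink f)
    assemble-e₃ : ∀ f t k → assemble f t (e₃ k) ≡ sink f k
    assemble-e₃ f t = layered-e₃ (sourceValues t) (middleValues f t) (sink f)

    free-assemble : ∀ f t i → free (assemble f t) i ≡ f i
    free-assemble f t@(δ , φ , η) zero
      rewrite Σℤ-cong (assemble-e₁ f t) | Σℤ-cong (assemble-e₂ f t) | assemble-e₃ f t zero =
      eq η (Σℤ δ) (f zero) (Σℤ φ) (+ c)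
      where
      eq : ∀ η s f t C → (η - s) + s + ((f - η - t) + (+ 0 + t)) + C * + 0 ≡ f
      eq = solve-∀
    free-assemble f t (suc k) = free-layered-sink (sourceValues t) (middleValues f t) f k

    finite-assemble : ∀ f t → finite (assemble f t) T.≈ t
    finite-assemble f t@(δ , φ , η) = ≡⇒≈
      (λ i → assemble-e₁ f t (suc i))
      (λ j → trans (cong₂ _-_ (assemble-e₂ f t (suc (suc j))) (assemble-e₂ f t (suc zero))) (ℤ.+-identityʳ (φ j)))
      (trans (cong₂ (λ s q → s + + b * q) (Σℤ-cong (assemble-e₁ f t)) (assemble-e₂ f t (suc zero)))
             (eq η (Σℤ δ) (+ b)))
      where
      eq : ∀ η s B → (η - s) + s + B * + 0 ≡ η
      eq = solve-∀

    atZero : ∀ {m} → ℤ → Fin (suc m) → ℤ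
    atZero y zero    = y
    atZero y (suc _) = + 0

    Σℤ-atZero : ∀ {m} y → Σℤ (atZero {m} y) ≡ y
    Σℤ-atZero {m} y = trans (cong (_+_ y) (Σℤ-zero {m})) (ℤ.+-identityʳ y)

    Σℤ-middle : ∀ u → Σℤ (λ j → middle j u) ≡ Σℤ (λ j → u (e₂ (suc (suc j)))) - + b′ * u q₁
    Σℤ-middle u = trans (Σℤ-- (λ j → u (e₂ (suc (suc j)))) (λ _ → u q₁))
      (cong (_-_ (Σℤ (λ j → u (e₂ (suc (suc j)))))) (Σℤ-const {b′} (u q₁)))

    splitWitness : (Fin n → ℤ) → Fin n → ℤ
    splitWitness u = layered (atZero (u q₁)) (atZero (u (e₃ zero))) 0ᶠ

    module _ (u : Fin n → ℤ) where
      private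
        x = splitWitness u
        t = finite u

      S₁-splitWitness : S₁ x ≡ u q₁
      S₁-splitWitness = trans (Σℤ-cong (layered-e₁ _ _ _)) (Σℤ-atZero {a′} (u q₁))

      S₂-splitWitness : S₂ x ≡ u (e₃ zero)
      S₂-splitWitness = trans (Σℤ-cong (layered-e₂ _ _ _)) (Σℤ-atZero {suc b′} (u (e₃ zero)))

      split-e₁ : ∀ i → assemble (free u) t (e₁ i) - u (e₁ i) ≡ + b * x (e₁ i)
      split-e₁ zero rewrite assemble-e₁ (free u) t zero | layered-e₁ (atZero (u q₁)) (atZero (u (e₃ zero))) 0ᶠ zero =
        eq (u (e₁ zero)) (Σℤ (λ i → u (e₁ (suc i)))) (u q₁) (+ b)
        where
        eq : ∀ p s q B → ((p + s) + B * q - s) - p ≡ B * q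
        eq = solve-∀
      split-e₁ (suc i) rewrite assemble-e₁ (free u) t (suc i)
                             | layered-e₁ (atZero (u q₁)) (atZero (u (e₃ zero))) 0ᶠ (suc i) =
        trans (ℤ.+-inverseʳ (u (e₁ (suc i)))) (sym (ℤ.*-zeroʳ (+ b)))

      split-e₂ : ∀ j → assemble (free u) t (e₂ j) - u (e₂ j) ≡ + c * x (e₂ j) - S₁ x
      split-e₂ zero rewrite assemble-e₂ (free u) t zero | layered-e₂ (atZero (u q₁)) (atZero (u (e₃ zero))) 0ᶠ zero
                          | S₁-splitWitness | Σℤ-middle u =
        eq (u (e₁ zero)) (Σℤ (λ i → u (e₁ (suc i)))) (u (e₂ zero)) (u q₁) (Σℤ (λ j → u (e₂ (suc (suc j)))))
           (u (e₃ zero)) (+ c) (+ b′)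
        where
        eq : ∀ p s q₀ q₁ sq r C b′ →
          (((p + s) + (q₀ + (q₁ + sq)) + C * r) - ((p + s) + (+ 2 + b′) * q₁) - (sq - b′ * q₁)) - q₀ ≡ C * r - q₁
        eq = solve-∀
      split-e₂ (suc zero) rewrite assemble-e₂ (free u) t (suc zero)
                                | layered-e₂ (atZero (u q₁)) (atZero (u (e₃ zero))) 0ᶠ (suc zero) | S₁-splitWitness =
        eq (u q₁) (+ c)
        where
        eq : ∀ q C → + 0 - q ≡ C * + 0 - q
        eq = solve-∀
      split-e₂ (suc (suc j)) rewrite assemble-e₂ (free u) t (suc (suc j))
                                   | layered-e₂ (atZero (u q₁)) (atZero (u (e₃ zero))) 0ᶠ (suc (suc j)) | S₁-splitWitness =
        eq (u (e₂ (suc (suc j)))) (u q₁) (+ c)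
        where
        eq : ∀ y q C → (y - q) - y ≡ C * + 0 - q
        eq = solve-∀

      split-e₃ : ∀ k → assemble (free u) t (e₃ k) - u (e₃ k) ≡ - S₂ x
      split-e₃ zero    rewrite assemble-e₃ (free u) t zero    | S₂-splitWitness = ℤ.+-identityˡ (- u (e₃ zero))
      split-e₃ (suc k) rewrite assemble-e₃ (free u) t (suc k) | S₂-splitWitness = eq (u (e₃ (suc k))) (u (e₃ zero))
        where
        eq : ∀ y r → (y - r) - y ≡ - r
        eq = solve-∀

    assemble-split : ∀ u → PicRel G (assemble (free u) (finite u)) u
    assemble-split u =
      PicRel-by-layer (assemble (free u) (finite u)) u (splitWitness u) (split-e₁ u) (split-e₂ u) (split-e₃ u)

    assemble-minus : ∀ {f f′} {t t′ s : T.Carrier} → (∀ i → f i ≡ f′ i) →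
      (∀ i → proj₁ t i - proj₁ t′ i ≡ proj₁ s i) →
      (∀ j → proj₁ (proj₂ t) j - proj₁ (proj₂ t′) j ≡ proj₁ (proj₂ s) j) →
      proj₂ (proj₂ t) - proj₂ (proj₂ t′) ≡ proj₂ (proj₂ s) →
      ∀ v → assemble f t v - assemble f′ t′ v ≡ assemble 0ᶠ s v
    assemble-minus {f} {f′} {t@(δ , φ , η)} {t′@(δ′ , φ′ , η′)} {s@(δˢ , φˢ , ηˢ)} f≡f′ δ-δ′ φ-φ′ η-η′ v =
      trans (layered-minus _ _ _ _ _ _ v) (layered-cong on-source on-middle on-sink v)
      where
      Σδ-δ′ : Σℤ δ - Σℤ δ′ ≡ Σℤ δˢ
      Σδ-δ′ = trans (sym (Σℤ-- δ δ′)) (Σℤ-cong δ-δ′)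
      Σφ-φ′ : Σℤ φ - Σℤ φ′ ≡ Σℤ φˢ
      Σφ-φ′ = trans (sym (Σℤ-- φ φ′)) (Σℤ-cong φ-φ′)
      on-source : ∀ i → sourceValues t i - sourceValues t′ i ≡ sourceValues s i
      on-source zero    = trans (eq η η′ (Σℤ δ) (Σℤ δ′)) (cong₂ _-_ η-η′ Σδ-δ′)
        where
        eq : ∀ a a′ s s′ → (a - s) - (a′ - s′) ≡ (a - a′) - (s - s′)
        eq = solve-∀
      on-source (suc i) = δ-δ′ i
      on-middle : ∀ j → middleValues f t j - middleValues f′ t′ j ≡ middleValues 0ᶠ s j
      on-middle zero = trans (eq (f zero) (f′ zero) η η′ (Σℤ φ) (Σℤ φ′))
        (cong₂ _-_ (cong₂ _-_ (ℤ.i≡j⇒i-j≡0 (f≡f′ zero)) η-η′) Σφ-φ′)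
        where
        eq : ∀ g g′ a a′ s s′ → (g - a - s) - (g′ - a′ - s′) ≡ (g - g′) - (a - a′) - (s - s′)
        eq = solve-∀
      on-middle (suc zero)    = refl
      on-middle (suc (suc j)) = φ-φ′ j
      on-sink : ∀ k → sink f k - sink f′ k ≡ sink 0ᶠ k
      on-sink zero    = refl
      on-sink (suc k) = ℤ.i≡j⇒i-j≡0 (f≡f′ (suc k))

    multiples : (Fin a′ → ℤ) → (Fin b′ → ℤ) → ℤ → T.Carrier
    multiples K M e = (λ i → K i * + b) , (λ j → M j * + c) , e * + (b ℕ.* c)

    kernelSource : (Fin a′ → ℤ) → ℤ → Fin (suc a′) → ℤ
    kernelSource K e zero    = + c * e - Σℤ K
    kernelSource K e (suc i) = K i

    kernelMiddle : (Fin b′ → ℤ) → ℤ → Fin b → ℤ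
    kernelMiddle M e zero          = e - + b * e - Σℤ M
    kernelMiddle M e (suc zero)    = e
    kernelMiddle M e (suc (suc j)) = M j + e

    kernelWitness : (Fin a′ → ℤ) → (Fin b′ → ℤ) → ℤ → Fin n → ℤ
    kernelWitness K M e = layered (kernelSource K e) (kernelMiddle M e) 0ᶠ

    module _ (K : Fin a′ → ℤ) (M : Fin b′ → ℤ) (e : ℤ) where
      private
        x = kernelWitness K M e
        t = multiples K M e
        Σ-*ʳ : ∀ {m} (L : Fin m → ℤ) k → Σℤ (λ i → L i * k) ≡ k * Σℤ L
        Σ-*ʳ L k = trans (Σℤ-cong (λ i → ℤ.*-comm (L i) k)) (Σℤ-* k L)

      S₁-kernelWitness : S₁ x ≡ + c * e
      S₁-kernelWitness = trans (Σℤ-cong (layered-e₁ _ _ _)) (eq (+ c * e) (Σℤ K))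
        where
        eq : ∀ y s → (y - s) + s ≡ y
        eq = solve-∀

      S₂-kernelWitness : S₂ x ≡ + 0
      S₂-kernelWitness rewrite Σℤ-cong (layered-e₂ (kernelSource K e) (kernelMiddle M e) 0ᶠ)
                             | Σℤ-+ M (λ _ → e) | Σℤ-const {b′} e = eq e (Σℤ M) (+ b′)
        where
        eq : ∀ e s b′ → (e - (+ 2 + b′) * e - s) + (e + (s + b′ * e)) ≡ + 0
        eq = solve-∀

      kernel-e₁ : ∀ i → assemble 0ᶠ t (e₁ i) - + 0 ≡ + b * x (e₁ i)
      kernel-e₁ i = trans (ℤ.+-identityʳ _)
        (trans (assemble-e₁ 0ᶠ t i) (trans (on-source i) (cong (+ b *_) (sym (layered-e₁ _ _ _ i)))))
        where
        on-source : ∀ i → sourceValues t i ≡ + b * kernelSource K e i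
        on-source zero    = trans (cong₂ _-_ (cong (e *_) bc≡b*c) (Σ-*ʳ K (+ b))) (eq e (+ b) (+ c) (Σℤ K))
          where
          eq : ∀ e B C s → e * (B * C) - B * s ≡ B * (C * e - s)
          eq = solve-∀
        on-source (suc i) = ℤ.*-comm (K i) (+ b)

      kernel-e₂ : ∀ j → assemble 0ᶠ t (e₂ j) - + 0 ≡ + c * x (e₂ j) - S₁ x
      kernel-e₂ j = trans (ℤ.+-identityʳ _) (trans (assemble-e₂ 0ᶠ t j)
        (trans (on-middle j) (cong₂ (λ y s → + c * y - s) (sym (layered-e₂ _ _ _ j)) (sym S₁-kernelWitness))))
        where
        on-middle : ∀ j → middleValues 0ᶠ t j ≡ + c * kernelMiddle M e j - + c * e
        on-middle zero = trans (cong₂ (λ p s → + 0 - p - s) (cong (e *_) bc≡b*c) (Σ-*ʳ M (+ c)))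
                               (eq e (+ b) (+ c) (Σℤ M))
          where
          eq : ∀ e B C s → + 0 - e * (B * C) - C * s ≡ C * (e - B * e - s) - C * e
          eq = solve-∀
        on-middle (suc zero)    = sym (ℤ.+-inverseʳ (+ c * e))
        on-middle (suc (suc j)) = eq (M j) (+ c) e
          where
          eq : ∀ m C e → m * C ≡ C * (m + e) - C * e
          eq = solve-∀

      kernel-e₃ : ∀ k → assemble 0ᶠ t (e₃ k) - + 0 ≡ - S₂ x
      kernel-e₃ k = trans (ℤ.+-identityʳ _)
        (trans (assemble-e₃ 0ᶠ t k) (trans (sink-zero k) (cong -_ (sym S₂-kernelWitness))))
        where
        sink-zero : ∀ k → sink 0ᶠ k ≡ + 0
        sink-zero zero    = refl
        sink-zero (suc k) = refl

    assemble-kernel : ∀ K M e → PicRel G (assemble 0ᶠ (multiples K M e)) 0ᶠ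
    assemble-kernel K M e =
      PicRel-by-layer (assemble 0ᶠ (multiples K M e)) 0ᶠ (kernelWitness K M e)
        (kernel-e₁ K M e) (kernel-e₂ K M e) (kernel-e₃ K M e)

    assemble-cong : ∀ {f f′ t t′} → (∀ i → f i ≡ f′ i) → t T.≈ t′ → PicRel G (assemble f t) (assemble f′ t′)
    assemble-cong {f} {f′} {δ , φ , η} {δ′ , φ′ , η′} f≡f′ (δ≈δ′ , φ≈φ′ , η≈η′) =
      PicRel-difference G {assemble f (δ , φ , η)} {assemble f′ (δ′ , φ′ , η′)}
        (assemble-minus f≡f′ (λ i → quotient-equation b {δ i} {δ′ i} (δ≈δ′ i))
                             (λ j → quotient-equation c {φ j} {φ′ j} (φ≈φ′ j))
                         (quotient-equation (b ℕ.* c) {η} {η′} η≈η′))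
        (assemble-kernel (λ i → quotient b {δ i} {δ′ i} (δ≈δ′ i)) (λ j → quotient c {φ j} {φ′ j} (φ≈φ′ j))
                         (quotient (b ℕ.* c) {η} {η′} η≈η′))
      where
      quotient : ∀ m {x y} → RawGroup._≈_ (ℤmod m) x y → ℤ
      quotient m {x} {y} p = _∣_.quotient (_≡_[mod_].m∣x-y (≈⇒≡[mod] m {x} {y} p))
      quotient-equation : ∀ m {x y} (p : RawGroup._≈_ (ℤmod m) x y) → x - y ≡ quotient m {x} {y} p * + m
      quotient-equation m {x} {y} p = _∣_.equality (_≡_[mod_].m∣x-y (≈⇒≡[mod] m {x} {y} p))

    decomposition : Decomposition G c T
    decomposition = record
      { free = free ; finite = finite ; assemble = assemble
      ; free-cong = λ {u} {v} → free-cong {u} {v} ; finite-cong = λ {u} {v} → finite-cong {u} {v}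
      ; assemble-cong = λ {f} {f′} {t} {t′} → assemble-cong {f} {f′} {t} {t′}
      ; free-+ = free-+ ; free-zero = free-zero ; free-neg = free-neg ; free-scale = free-scale
      ; finite-+ = finite-+ ; finite-zero = finite-zero ; finite-neg = finite-neg
      ; free-assemble = free-assemble ; finite-assemble = finite-assemble
      ; assemble-split = assemble-split
      ; exponent = b ℕ.* c ; exponent-pos = ℕ.s≤s ℕ.z≤n ; finite-exponent = finite-exponent }

    Jac≃cyclicFactors : Jacᶜ G ≃ ℤ_b ^ᶜ a′ ⊗ᶜ ℤ_c ^ᶜ b′ ⊗ᶜ ℤ_bc
    Jac≃cyclicFactors = begin
      Jacᶜ G                                  ≈⟨ Jac≃T decomposition ⟩
      Vecᶜ ℤ_b a′ ⊗ᶜ (Vecᶜ ℤ_c b′ ⊗ᶜ ℤ_bc)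
        ≈⟨ ⊗-congˡ (Vecᶜ ℤ_b a′) (ℤ_b ^ᶜ a′) (Vecᶜ ℤ_c b′ ⊗ᶜ ℤ_bc) (Vec≃^ ℤ_b a′) ⟩
      ℤ_b ^ᶜ a′ ⊗ᶜ (Vecᶜ ℤ_c b′ ⊗ᶜ ℤ_bc)
        ≈⟨ ⊗-congʳ (ℤ_b ^ᶜ a′) (Vecᶜ ℤ_c b′ ⊗ᶜ ℤ_bc) (ℤ_c ^ᶜ b′ ⊗ᶜ ℤ_bc)
                   (⊗-congˡ (Vecᶜ ℤ_c b′) (ℤ_c ^ᶜ b′) ℤ_bc (Vec≃^ ℤ_c b′)) ⟩
      ℤ_b ^ᶜ a′ ⊗ᶜ (ℤ_c ^ᶜ b′ ⊗ᶜ ℤ_bc)       ∎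
      where open ≃-Reasoning

    Jac≃-surplus-source : b′ ℕ.≤ a′ → Jacᶜ G ≃ ℤ_g ^ᶜ b′ ⊗ᶜ ℤ_b ^ᶜ (a′ ℕ.∸ b′) ⊗ᶜ ℤ_l ^ᶜ b′ ⊗ᶜ ℤ_bc
    Jac≃-surplus-source b′≤a′ = ≃-trans (Jacᶜ G) (ℤ_b ^ᶜ a′ ⊗ᶜ ℤ_c ^ᶜ b′ ⊗ᶜ ℤ_bc)
      (ℤ_g ^ᶜ b′ ⊗ᶜ ℤ_b ^ᶜ (a′ ℕ.∸ b′) ⊗ᶜ ℤ_l ^ᶜ b′ ⊗ᶜ ℤ_bc)
      Jac≃cyclicFactors (pair-off-surplusˡ ℤ_b ℤ_c ℤ_g ℤ_l ℤ_bc crt b′≤a′)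
      where crt = ChineseRemainder.crt (gcdLcmCofactors b c)

    Jac≃-surplus-middle : a′ ℕ.≤ b′ → Jacᶜ G ≃ ℤ_g ^ᶜ a′ ⊗ᶜ ℤ_c ^ᶜ (b′ ℕ.∸ a′) ⊗ᶜ ℤ_l ^ᶜ a′ ⊗ᶜ ℤ_bc
    Jac≃-surplus-middle a′≤b′ = ≃-trans (Jacᶜ G) (ℤ_b ^ᶜ a′ ⊗ᶜ ℤ_c ^ᶜ b′ ⊗ᶜ ℤ_bc)
      (ℤ_g ^ᶜ a′ ⊗ᶜ ℤ_c ^ᶜ (b′ ℕ.∸ a′) ⊗ᶜ ℤ_l ^ᶜ a′ ⊗ᶜ ℤ_bc)
      Jac≃cyclicFactors (pair-off-surplusʳ ℤ_b ℤ_c ℤ_g ℤ_l ℤ_bc crt a′≤b′)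
      where crt = ChineseRemainder.crt (gcdLcmCofactors b c)

open import Defs
open ThreeLayerPicard
open import Data.Nat using (ℕ; _≤_; _∸_; _+_; _*_; zero; suc; s≤s)
import Data.Nat.Properties as ℕ
open import Data.Nat.GCD using (gcd)
open import Data.Nat.LCM using (lcm)
open import Data.Fin using (Fin; zero; suc)
open import Data.Product using (_×_; _,_; proj₁)
open import Relation.Binary.PropositionalEquality using (_≡_; subst; sym; cong)

theorem6p6 : (n a b c : ℕ) (G : DiGraph n) (layer : Fin n → Fin 3) →
    IsSingleFlow G layer →
    layerSize layer zero ≡ a →
    layerSize layer (suc zero) ≡ b →
    layerSize layer (suc (suc zero)) ≡ c →
    (Pic G ≅ (ℤ-group ^ c) ⊗ Jac G)
    × (b ≡ 1 → Jac G ≅ trivialGroup)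
    × (b ∸ 1 ≤ a → 2 ≤ b →
         Jac G ≅ (ℤmod (gcd b c) ^ (b ∸ 2)) ⊗ (ℤmod b ^ (a + 1 ∸ b))
                   ⊗ (ℤmod (lcm b c) ^ (b ∸ 2)) ⊗ ℤmod (b * c))
    × (a ≤ b ∸ 1 →
         Jac G ≅ (ℤmod (gcd b c) ^ (a ∸ 1)) ⊗ (ℤmod c ^ (b ∸ a ∸ 1))
                   ⊗ (ℤmod (lcm b c) ^ (a ∸ 1)) ⊗ ℤmod (b * c))
theorem6p6 n zero b c G layer sf ea eb ec with () ← subst (1 ≤_) ea (proj₁ sf zero)
theorem6p6 n (suc a′) zero c G layer sf ea eb ec with () ← subst (1 ≤_) eb (proj₁ sf (suc zero))
theorem6p6 n (suc a′) b zero G layer sf ea eb ec with () ← subst (1 ≤_) ec (proj₁ sf (suc (suc zero)))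
theorem6p6 n (suc a′) 1 (suc c′) G layer (_ , arrows) ea eb ec =
  Pic≃ℤ^c⊗Jac D , (λ _ → Jac≃T D) , (λ _ → λ { (s≤s ()) }) , λ ()
  where
  D = MiddleLayerOfSizeOne.decomposition G layer arrows (layerEnumerationOfSizes layer ea eb ec)
theorem6p6 n (suc a′) (suc (suc b′)) (suc c′) G layer (_ , arrows) ea eb ec =
  Pic≃ℤ^c⊗Jac decomposition , (λ ()) ,
  (λ { (s≤s b′≤a′) _ → subst (λ d → Jacᶜ G ≃ ℤ_g ^ᶜ b′ ⊗ᶜ ℤ_b ^ᶜ d ⊗ᶜ ℤ_l ^ᶜ b′ ⊗ᶜ ℤ_bc)
                             (cong (_∸ suc b′) (ℕ.+-comm 1 a′)) (Jac≃-surplus-source b′≤a′) }) ,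
  (λ { (s≤s a′≤b′) → subst (λ d → Jacᶜ G ≃ ℤ_g ^ᶜ a′ ⊗ᶜ ℤ_c ^ᶜ d ⊗ᶜ ℤ_l ^ᶜ a′ ⊗ᶜ ℤ_bc)
                           (sym (cong (_∸ 1) (ℕ.+-∸-assoc 1 a′≤b′))) (Jac≃-surplus-middle a′≤b′) })
  where open MiddleLayerOfSizeAtLeastTwo G layer arrows (layerEnumerationOfSizes layer ea eb ec)
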